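{- (Inversion lemma for LBIZ.) Let $k\ge 1$, and let $\Gamma(-)$ be a context, $\Gamma,\Gamma_1$ structures and $F,G,F_1,F_2,H$ formulas. In each of the following pairs, if the sequent on the left is derivable in LBIZ with derivation depth at most $k$, then the sequent(s) on the right are derivable in LBIZ with derivation depth at most $k$: (1) $\Gamma(F\wedge G)\vdash H$ $\Rightarrow$ $\Gamma(F;G)\vdash H$; (2) $\Gamma(F_1\vee F_2)\vdash H$ $\Rightarrow$ both $\Gamma(F_1)\vdash H$ and $\Gamma(F_2)\vdash H$; (3) $\Gamma(F*G)\vdash H$ $\Rightarrow$ $\Gamma(F,G)\vdash H$; (4) $\Gamma(\Gamma_1;\top)\vdash H$ $\Rightarrow$ $\Gamma(\Gamma_1)\vdash H$; (5) $\Gamma(\Gamma_1,{}^*\!\top)\vdash H$ $\Rightarrow$ $\Gamma(\Gamma_1)\vdash H$; (6) $\Gamma\vdash F\wedge G$ $\Rightarrow$ both $\Gamma\vdash F$ and $\Gamma\vdash G$; (7) $\Gamma\vdash F\supset G$ $\Rightarrow$ $\Gamma;F\vdash G$; (8) $\Gamma\vdash F\mathrel{ -\!*}G$ $\Rightarrow$ $\Gamma,F\vdash G$.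
   Context: BI formulas: $F ::= p \mid \top \mid \bot \mid {}^*\!\top \mid F\wedge F \mid F\vee F \mid F\supset F \mid F * F \mid F \mathrel{ -\!*} F$, with $p$ ranging over propositional variables (${}^*\!\top$ is the multiplicative unit, $\mathrel{ -\!*}$ the multiplicative implication). Structures (bunches): $\Gamma ::= F \mid \Gamma;\Gamma \mid \Gamma,\Gamma$; the additive connective ";" and the multiplicative connective "," are each associative and commutative (structures are taken modulo these laws), neither distributes over the other, and there are no empty structures or structural units. A context $\Gamma(-)$ is a structure with one hole; $\Gamma(\Delta)$ is the result of filling the hole with $\Delta$. A sequent is $\Gamma \vdash F$. We write $\widetilde{\Gamma}$ for a structure that may be absent, with the conventions $\widetilde{\Gamma_1};\Gamma_2=\Gamma_2$ and $\widetilde{\Gamma_1},\Gamma_2=\Gamma_2$ when $\Gamma_1$ is absent. Essences: the set of essences of a structure $\Gamma_1$ is the least set such that (i) $\Gamma_1$ is an essence of $\Gamma_1$; (ii) if $\Gamma(\Gamma')$ is an essence of $\Gamma_1$ then so is $\Gamma(\Gamma',({}^*\!\top;\widetilde{\Gamma_2}))$ for any possibly-absent $\Gamma_2$; (iii) if $\Gamma(\Gamma';\Gamma'')$ is an essence of $\Gamma_1$ then so is $\Gamma((\Gamma',({}^*\!\top;\widetilde{\Gamma_2}));\Gamma'')$. $\mathbb{E}(\Gamma_1)$ denotes an essence of $\Gamma_1$; within one rule instance the same $\mathbb{E}(\cdot)$ in premises and conclusion denotes the same structure (up to the part modified by the rule). Relation $\preceq$: the least reflexive, transitive relation on structures with $\Gamma(\Gamma_1)\preceq\Gamma(\Gamma_1;\Gamma')$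 for all contexts and structures. $\mathrm{Candidate}(\Gamma)=\{(\Gamma_x,{}^*\!\top): \Gamma_x\preceq\Gamma\}\cup\{(\Gamma_x,\Gamma_y):(\Gamma_x,\Gamma_y)\preceq\Gamma\}$. The calculus LBIZ (no structural rules) has the rules: axioms $id$: $\mathbb{E}(\widetilde{\Gamma};p)\vdash p$ ($p$ a propositional variable); $\bot L$: $\Gamma(\bot)\vdash H$; $\top R$: $\Gamma\vdash\top$; ${}^*\!\top R$: $\mathbb{E}(\widetilde{\Gamma};{}^*\!\top)\vdash{}^*\!\top$. $\wedge L$: from $\Gamma(F;G)\vdash H$ infer $\Gamma(F\wedge G)\vdash H$. $\wedge R$: from $\Gamma\vdash F$ and $\Gamma\vdash G$ infer $\Gamma\vdash F\wedge G$. $\vee L$: from $\Gamma(F)\vdash H$ and $\Gamma(G)\vdash H$ infer $\Gamma(F\vee G)\vdash H$. $\vee R$: from $\Gamma\vdash F_i$ infer $\Gamma\vdash F_1\vee F_2$ ($i\in\{1,2\}$). $\supset L$: from $\mathbb{E}(\widetilde{\Gamma_1};F\supset G)\vdash F$ and $\Gamma(G;\mathbb{E}(\widetilde{\Gamma_1};F\supset G))\vdash H$ infer $\Gamma(\mathbb{E}(\widetilde{\Gamma_1};F\supset G))\vdash H$. $\supset R$: from $\Gamma;F\vdash G$ infer $\Gamma\vdash F\supset G$. $*L$: from $\Gamma(F,G)\vdash H$ infer $\Gamma(F*G)\vdash H$. $*R$: from $Re_i\vdash F_1$ and $Re_j\vdash F_2$ infer $\Gamma'\vdash F_1*F_2$,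 where $\{i,j\}=\{1,2\}$ and $(Re_1,Re_2)\in\mathrm{Candidate}(\Gamma')$. $\mathrel{ -\!*}L$: from $Re_i\vdash F$ and $\Gamma((\widetilde{Re_j},G);(\widetilde{\Gamma'},\mathbb{E}(\widetilde{\Gamma_1};F\mathrel{ -\!*}G)))\vdash H$ infer $\Gamma(\widetilde{\Gamma'},\mathbb{E}(\widetilde{\Gamma_1};F\mathrel{ -\!*}G))\vdash H$, where $\{i,j\}=\{1,2\}$; if $\Gamma'$ is present then $(Re_1,Re_2)\in\mathrm{Candidate}(\Gamma')$, otherwise $Re_i={}^*\!\top$ and $Re_j$ is absent. $\mathrel{ -\!*}R$: from $\Gamma,F\vdash G$ infer $\Gamma\vdash F\mathrel{ -\!*}G$. Derivation depth of a sequent in a closed derivation: 1 if it is the conclusion of an axiom; otherwise 1 plus the maximum of the depths of the premises of the last rule. -}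

module Defs where

open import Data.Nat using (ℕ; suc; _⊔_; _≤_)
open import Data.Maybe using (Maybe; just; nothing)
open import Data.Product using (Σ)

infixr 30 _∧ᶠ_
infixr 29 _∨ᶠ_
infixr 30 _✶_
infixr 25 _⊃_
infixr 25 _-✶_

data Formula : Set where
  var  : ℕ → Formula
  ⊤ᶠ   : Formula
  ⊥ᶠ   : Formula
  ⊤*   : Formula
  _∧ᶠ_ : Formula → Formula → Formula
  _∨ᶠ_ : Formula → Formula → Formula
  _⊃_  : Formula → Formula → Formula
  _✶_  : Formula → Formula → Formula
  _-✶_ : Formula → Formula → Formula

-- Structures (bunches), represented as trees; they are taken modulo
-- associativity and commutativity of ";" and "," via _≈_ below.

infixl 20 _；_
infixl 21 _，_

data Str : Set where
  ⌊_⌋ : Formula → Str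
  _；_ : Str → Str → Str
  _，_ : Str → Str → Str

-- AC-equivalence of structures (no distributivity, no units)
infix 4 _≈_
data _≈_ : Str → Str → Set where
  ≈-refl   : ∀ {A} → A ≈ A
  ≈-sym    : ∀ {A B} → A ≈ B → B ≈ A
  ≈-trans  : ∀ {A B C} → A ≈ B → B ≈ C → A ≈ C
  ；-cong   : ∀ {A A' B B'} → A ≈ A' → B ≈ B' → (A ； B) ≈ (A' ； B')
  ，-cong   : ∀ {A A' B B'} → A ≈ A' → B ≈ B' → (A ， B) ≈ (A' ， B')
  ；-assoc  : ∀ {A B C} → ((A ； B) ； C) ≈ (A ； (B ； C))
  ；-comm   : ∀ {A B} → (A ； B) ≈ (B ； A)
  ，-assoc  : ∀ {A B C} → ((A ， B) ， C) ≈ (A ， (B ， C))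
  ，-comm   : ∀ {A B} → (A ， B) ≈ (B ， A)

-- Possibly-absent structures and the conventions Γ̃₁;Γ₂ = Γ₂, Γ̃₁,Γ₂ = Γ₂
_；?_ : Maybe Str → Str → Str
nothing ；? B = B
just A  ；? B = A ； B

_，?_ : Maybe Str → Str → Str
nothing ，? B = B
just A  ，? B = A ， B

data Ctx : Set where
  ─    : Ctx
  _；ˡ_ : Ctx → Str → Ctx
  _；ʳ_ : Str → Ctx → Ctx
  _，ˡ_ : Ctx → Str → Ctx
  _，ʳ_ : Str → Ctx → Ctx

infix 40 _[_]
_[_] : Ctx → Str → Str
─ [ D ] = D
(C ；ˡ B) [ D ] = (C [ D ]) ； B
(A ；ʳ C) [ D ] = A ； (C [ D ])
(C ，ˡ B) [ D ] = (C [ D ]) ， B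
(A ，ʳ C) [ D ] = A ， (C [ D ])

-- Essences: Ess Γ₁ Δ  means  "Δ is an essence of Γ₁"
-- (closed under ≈ since structures are taken modulo AC)

data Ess (Γ₁ : Str) : Str → Set where
  ess-self : Ess Γ₁ Γ₁
  ess-≈    : ∀ {Δ Δ'} → Ess Γ₁ Δ → Δ ≈ Δ' → Ess Γ₁ Δ'
  ess-ii   : ∀ (C : Ctx) (Γ' : Str) (Γ₂ : Maybe Str) →
             Ess Γ₁ (C [ Γ' ]) →
             Ess Γ₁ (C [ Γ' ， (Γ₂ ；? ⌊ ⊤* ⌋) ])
  ess-iii  : ∀ (C : Ctx) (Γ' Γ'' : Str) (Γ₂ : Maybe Str) →
             Ess Γ₁ (C [ Γ' ； Γ'' ]) →
             Ess Γ₁ (C [ (Γ' ， (Γ₂ ；? ⌊ ⊤* ⌋)) ； Γ'' ])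

infix 4 _⪯_
data _⪯_ : Str → Str → Set where
  ⪯-≈     : ∀ {A B} → A ≈ B → A ⪯ B
  ⪯-trans : ∀ {A B C} → A ⪯ B → B ⪯ C → A ⪯ C
  ⪯-weak  : ∀ (C : Ctx) (Γ₁ Γ' : Str) → C [ Γ₁ ] ⪯ C [ Γ₁ ； Γ' ]

-- Candidate Γ Re₁ Re₂  means  (Re₁ , Re₂) ∈ Candidate(Γ)
data Candidate (Γ : Str) : Str → Str → Set where
  cand-unit : ∀ {Γx} → Γx ⪯ Γ → Candidate Γ Γx ⌊ ⊤* ⌋
  cand-pair : ∀ {Γx Γy} → (Γx ， Γy) ⪯ Γ → Candidate Γ Γx Γy

-- LBIZ derivations  (Deriv Γ H : closed derivations of Γ ⊢ H)
-- Each rule's conclusion is matched modulo ≈.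

data Deriv : Str → Formula → Set where
  id    : ∀ {Γ} (m : Maybe Str) (p : ℕ) →
          Ess (m ；? ⌊ var p ⌋) Γ → Deriv Γ (var p)
  ⊥L    : ∀ {Γ H} (C : Ctx) → Γ ≈ C [ ⌊ ⊥ᶠ ⌋ ] → Deriv Γ H
  ⊤R    : ∀ {Γ} → Deriv Γ ⊤ᶠ
  ⊤*R   : ∀ {Γ} (m : Maybe Str) →
          Ess (m ；? ⌊ ⊤* ⌋) Γ → Deriv Γ ⊤*
  ∧L    : ∀ {Γ H} (C : Ctx) (F G : Formula) → Γ ≈ C [ ⌊ F ∧ᶠ G ⌋ ] →
          Deriv (C [ ⌊ F ⌋ ； ⌊ G ⌋ ]) H → Deriv Γ H
  ∧R    : ∀ {Γ F G} → Deriv Γ F → Deriv Γ G → Deriv Γ (F ∧ᶠ G)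
  ∨L    : ∀ {Γ H} (C : Ctx) (F G : Formula) → Γ ≈ C [ ⌊ F ∨ᶠ G ⌋ ] →
          Deriv (C [ ⌊ F ⌋ ]) H → Deriv (C [ ⌊ G ⌋ ]) H → Deriv Γ H
  ∨R₁   : ∀ {Γ F G} → Deriv Γ F → Deriv Γ (F ∨ᶠ G)
  ∨R₂   : ∀ {Γ F G} → Deriv Γ G → Deriv Γ (F ∨ᶠ G)
  ⊃L    : ∀ {Γ H} (C : Ctx) (m : Maybe Str) (F G : Formula) (E : Str) →
          Ess (m ；? ⌊ F ⊃ G ⌋) E → Γ ≈ C [ E ] →
          Deriv E F → Deriv (C [ ⌊ G ⌋ ； E ]) H → Deriv Γ H
  ⊃R    : ∀ {Γ F G} → Deriv (Γ ； ⌊ F ⌋) G → Deriv Γ (F ⊃ G)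
  ✶L    : ∀ {Γ H} (C : Ctx) (F G : Formula) → Γ ≈ C [ ⌊ F ✶ G ⌋ ] →
          Deriv (C [ ⌊ F ⌋ ， ⌊ G ⌋ ]) H → Deriv Γ H
  -- *R with (i,j) = (1,2) and with (i,j) = (2,1)
  ✶R₁₂  : ∀ {Γ F₁ F₂} (Re₁ Re₂ : Str) → Candidate Γ Re₁ Re₂ →
          Deriv Re₁ F₁ → Deriv Re₂ F₂ → Deriv Γ (F₁ ✶ F₂)
  ✶R₂₁  : ∀ {Γ F₁ F₂} (Re₁ Re₂ : Str) → Candidate Γ Re₁ Re₂ →
          Deriv Re₂ F₁ → Deriv Re₁ F₂ → Deriv Γ (F₁ ✶ F₂)
  -- -*L with Γ' present, (i,j) = (1,2) and (i,j) = (2,1)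
  -✶L₁₂ : ∀ {Γ H} (C : Ctx) (Γ' : Str) (m : Maybe Str) (F G : Formula)
          (E Re₁ Re₂ : Str) → Candidate Γ' Re₁ Re₂ →
          Ess (m ；? ⌊ F -✶ G ⌋) E → Γ ≈ C [ Γ' ， E ] →
          Deriv Re₁ F → Deriv (C [ (Re₂ ， ⌊ G ⌋) ； (Γ' ， E) ]) H →
          Deriv Γ H
  -✶L₂₁ : ∀ {Γ H} (C : Ctx) (Γ' : Str) (m : Maybe Str) (F G : Formula)
          (E Re₁ Re₂ : Str) → Candidate Γ' Re₁ Re₂ →
          Ess (m ；? ⌊ F -✶ G ⌋) E → Γ ≈ C [ Γ' ， E ] →
          Deriv Re₂ F → Deriv (C [ (Re₁ ， ⌊ G ⌋) ； (Γ' ， E) ]) H →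
          Deriv Γ H
  -- -*L with Γ' absent: Re_i = *⊤ and Re_j absent
  -✶L₀  : ∀ {Γ H} (C : Ctx) (m : Maybe Str) (F G : Formula) (E : Str) →
          Ess (m ；? ⌊ F -✶ G ⌋) E → Γ ≈ C [ E ] →
          Deriv ⌊ ⊤* ⌋ F → Deriv (C [ ⌊ G ⌋ ； E ]) H → Deriv Γ H
  -✶R   : ∀ {Γ F G} → Deriv (Γ ， ⌊ F ⌋) G → Deriv Γ (F -✶ G)

depth : ∀ {Γ H} → Deriv Γ H → ℕ
depth (id _ _ _) = 1
depth (⊥L _ _) = 1
depth ⊤R = 1
depth (⊤*R _ _) = 1
depth (∧L _ _ _ _ d) = suc (depth d)
depth (∧R d e) = suc (depth d ⊔ depth e)
depth (∨L _ _ _ _ d e) = suc (depth d ⊔ depth e)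
depth (∨R₁ d) = suc (depth d)
depth (∨R₂ d) = suc (depth d)
depth (⊃L _ _ _ _ _ _ _ d e) = suc (depth d ⊔ depth e)
depth (⊃R d) = suc (depth d)
depth (✶L _ _ _ _ d) = suc (depth d)
depth (✶R₁₂ _ _ _ d e) = suc (depth d ⊔ depth e)
depth (✶R₂₁ _ _ _ d e) = suc (depth d ⊔ depth e)
depth (-✶L₁₂ _ _ _ _ _ _ _ _ _ _ _ d e) = suc (depth d ⊔ depth e)
depth (-✶L₂₁ _ _ _ _ _ _ _ _ _ _ _ d e) = suc (depth d ⊔ depth e)
depth (-✶L₀ _ _ _ _ _ _ _ d e) = suc (depth d ⊔ depth e)
depth (-✶R d) = suc (depth d)

DerivableIn : ℕ → Str → Formula → Set
DerivableIn k Γ H = Σ (Deriv Γ H) (λ d → depth d ≤ k)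

module Submission where

-- Items (1)-(5) are all instances of one principle: a local rewrite of the
-- antecedent preserves derivability at the same depth.  We prove it, by
-- induction on the depth bound, for three rewrites:
--   * replacing a leaf ∧/∨/✶-formula by (one of) its premise structures,
--     or a leaf ⊤ by anything (`Replacement`, giving (1)-(3));
--   * deleting a ⊤ that is an argument of ";" (`DropUnit`, giving (4));
--   * deleting a ⊤* that is an argument of "," (`DropMultiplicativeUnit`,
--     giving (5)).
-- Each proof locates the rewrite relative to the principal part of the
-- last rule: in its context it commutes with the rule; otherwise it falls
-- inside an essence, a candidate pair, or is a principal case.  Items (6)-(8) follow from one generic
-- fact: left rules can be re-applied under an outer context (`invert`).

open import Defs
open import Data.Nat using (ℕ; _≤_; suc; _⊔_; s≤s)
open import Data.Nat.Properties using (m⊔n≤o⇒m≤o; m⊔n≤o⇒n≤o; ⊔-lub; m≤n⇒m≤1+n; <⇒≤)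
open import Data.Product using (_×_; Σ; _,_; proj₁; proj₂)
open import Data.Sum using (_⊎_; inj₁; inj₂; swap)
open import Data.Maybe using (Maybe; just; nothing)
open import Data.Empty using (⊥-elim)
open import Relation.Binary.PropositionalEquality using (_≡_; _≢_; refl; sym; trans; cong; cong₂; subst)

⊔≤ˡ : ∀ {a b n} → a ⊔ b ≤ n → a ≤ n
⊔≤ˡ = m⊔n≤o⇒m≤o _ _

⊔≤ʳ : ∀ {a b n} → a ⊔ b ≤ n → b ≤ n
⊔≤ʳ = m⊔n≤o⇒n≤o _ _

binary≤ : ∀ {a b n} → a ≤ n → b ≤ n → suc (a ⊔ b) ≤ suc n
binary≤ p q = s≤s (⊔-lub p q)

plug-cong : ∀ C {A B} → A ≈ B → C [ A ] ≈ C [ B ]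
plug-cong ─ e = e
plug-cong (C ；ˡ B) e = ；-cong (plug-cong C e) ≈-refl
plug-cong (A ；ʳ C) e = ；-cong ≈-refl (plug-cong C e)
plug-cong (C ，ˡ B) e = ，-cong (plug-cong C e) ≈-refl
plug-cong (A ，ʳ C) e = ，-cong ≈-refl (plug-cong C e)

_∘ᶜ_ : Ctx → Ctx → Ctx
─ ∘ᶜ D = D
(C ；ˡ B) ∘ᶜ D = (C ∘ᶜ D) ；ˡ B
(A ；ʳ C) ∘ᶜ D = A ；ʳ (C ∘ᶜ D)
(C ，ˡ B) ∘ᶜ D = (C ∘ᶜ D) ，ˡ B
(A ，ʳ C) ∘ᶜ D = A ，ʳ (C ∘ᶜ D)

plug-∘ : ∀ C D X → (C ∘ᶜ D) [ X ] ≡ C [ D [ X ] ]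
plug-∘ ─ D X = refl
plug-∘ (C ；ˡ B) D X = cong (_； B) (plug-∘ C D X)
plug-∘ (A ；ʳ C) D X = cong (A ；_) (plug-∘ C D X)
plug-∘ (C ，ˡ B) D X = cong (_， B) (plug-∘ C D X)
plug-∘ (A ，ʳ C) D X = cong (A ，_) (plug-∘ C D X)

-- Leaves are rigid: a single formula is AC-equivalent only to itself,
-- because AC-equivalence preserves the "leaf or not" shape of the root.

leafOf : Str → Maybe Formula
leafOf ⌊ f ⌋ = just f
leafOf (_ ； _) = nothing
leafOf (_ ， _) = nothing

≈-leafOf : ∀ {A B} → A ≈ B → leafOf A ≡ leafOf B
≈-leafOf ≈-refl = refl
≈-leafOf (≈-sym e) = sym (≈-leafOf e)
≈-leafOf (≈-trans e f) = trans (≈-leafOf e) (≈-leafOf f)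
≈-leafOf (；-cong _ _) = refl
≈-leafOf (，-cong _ _) = refl
≈-leafOf ；-assoc = refl
≈-leafOf ；-comm = refl
≈-leafOf ，-assoc = refl
≈-leafOf ，-comm = refl

leafOf-just : ∀ {B f} → leafOf B ≡ just f → B ≡ ⌊ f ⌋
leafOf-just {⌊ _ ⌋} refl = refl

leaf-rigidʳ : ∀ {f B} → ⌊ f ⌋ ≈ B → B ≡ ⌊ f ⌋
leaf-rigidʳ e = leafOf-just (sym (≈-leafOf e))

leaf-rigidˡ : ∀ {f B} → B ≈ ⌊ f ⌋ → B ≡ ⌊ f ⌋
leaf-rigidˡ e = leafOf-just (≈-leafOf e)

plug-leaf : ∀ C {X f} → C [ X ] ≡ ⌊ f ⌋ → (C ≡ ─) × (X ≡ ⌊ f ⌋)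
plug-leaf ─ e = refl , e
plug-leaf (C ；ˡ x) ()
plug-leaf (x ；ʳ C) ()
plug-leaf (C ，ˡ x) ()
plug-leaf (x ，ʳ C) ()

plug-，-not-leaf : ∀ C {A B f} → C [ A ， B ] ≢ ⌊ f ⌋
plug-，-not-leaf C e with plug-leaf C e
... | refl , ()

plug-；-not-leaf : ∀ C {A B f} → C [ A ； B ] ≢ ⌊ f ⌋
plug-；-not-leaf C e with plug-leaf C e
... | refl , ()

-- Rule (iii) of the definition is rule (ii) applied in the
-- context C ∘ᶜ (─ ；ˡ Γ''), so essences are equally generated by (i), (ii)
-- and AC-equivalence alone; this presentation has fewer cases to analyse.

data Essence (Γ₁ : Str) : Str → Set where
  e-self : Essence Γ₁ Γ₁
  e-≈    : ∀ {Δ Δ'} → Essence Γ₁ Δ → Δ ≈ Δ' → Essence Γ₁ Δ'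
  e-ii   : ∀ (C : Ctx) (Γ' : Str) (Γ₂ : Maybe Str) →
           Essence Γ₁ (C [ Γ' ]) → Essence Γ₁ (C [ Γ' ， (Γ₂ ；? ⌊ ⊤* ⌋) ])

toEssence : ∀ {Γ₁ Δ} → Ess Γ₁ Δ → Essence Γ₁ Δ
toEssence ess-self = e-self
toEssence (ess-≈ e x) = e-≈ (toEssence e) x
toEssence (ess-ii C Γ' Γ₂ e) = e-ii C Γ' Γ₂ (toEssence e)
toEssence (ess-iii C Γ' Γ'' Γ₂ e) =
  subst (Essence _) (plug-∘ C D (Γ' ， (Γ₂ ；? ⌊ ⊤* ⌋)))
    (e-ii (C ∘ᶜ D) Γ' Γ₂ (subst (Essence _) (sym (plug-∘ C D Γ')) (toEssence e)))
  where
  D : Ctx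
  D = ─ ；ˡ Γ''

fromEssence : ∀ {Γ₁ Δ} → Essence Γ₁ Δ → Ess Γ₁ Δ
fromEssence e-self = ess-self
fromEssence (e-≈ e x) = ess-≈ (fromEssence e) x
fromEssence (e-ii C Γ' Γ₂ e) = ess-ii C Γ' Γ₂ (fromEssence e)

essence-base-≈ : ∀ {A B Δ} → Essence A Δ → A ≈ B → Essence B Δ
essence-base-≈ e-self eq = e-≈ e-self (≈-sym eq)
essence-base-≈ (e-≈ e x) eq = e-≈ (essence-base-≈ e eq) x
essence-base-≈ (e-ii C Γ' Γ₂ e) eq = e-ii C Γ' Γ₂ (essence-base-≈ e eq)

-- Rule (ii) never produces a leaf, so a leaf is an essence only of itself.
essence-leaf : ∀ {Γ₁ Δ f} → Essence Γ₁ Δ → Δ ≡ ⌊ f ⌋ → Γ₁ ≡ ⌊ f ⌋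
essence-leaf e-self p = p
essence-leaf (e-≈ e x) refl = essence-leaf e (leaf-rigidˡ x)
essence-leaf (e-ii C Γ' Γ₂ e) p = ⊥-elim (plug-，-not-leaf C p)

essence-leaf-head : ∀ {m P f} → Ess (m ；? ⌊ P ⌋) ⌊ f ⌋ → P ≡ f
essence-leaf-head {nothing} e with essence-leaf (toEssence e) refl
... | refl = refl
essence-leaf-head {just _} e with essence-leaf (toEssence e) refl
... | ()

-- Similarly only a leaf is ⪯ a leaf (weakening adds a ";" node).
⪯-leaf : ∀ {X S f} → X ⪯ S → S ≡ ⌊ f ⌋ → X ≡ ⌊ f ⌋
⪯-leaf (⪯-≈ x) refl = leaf-rigidˡ x
⪯-leaf (⪯-trans p q) e = ⪯-leaf p (⪯-leaf q e)
⪯-leaf (⪯-weak C Γ₁ Γ') e = ⊥-elim (plug-；-not-leaf C e)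

candidate-⊤* : ∀ {R₁ R₂} → Candidate ⌊ ⊤* ⌋ R₁ R₂ → (R₁ ≡ ⌊ ⊤* ⌋) × (R₂ ≡ ⌊ ⊤* ⌋)
candidate-⊤* (cand-unit p) = ⪯-leaf p refl , refl
candidate-⊤* (cand-pair p) with ⪯-leaf p refl
... | ()

candidate-≈ : ∀ {A B R₁ R₂} → Candidate A R₁ R₂ → A ≈ B → Candidate B R₁ R₂
candidate-≈ (cand-unit x) e = cand-unit (⪯-trans x (⪯-≈ e))
candidate-≈ (cand-pair x) e = cand-pair (⪯-trans x (⪯-≈ e))

-- Every rule matches its conclusion modulo ≈, so derivations transfer
-- along ≈ with unchanged depth.
derivation-≈ : ∀ {A B H} (d : Deriv A H) → A ≈ B → Σ (Deriv B H) λ d' → depth d' ≡ depth d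
derivation-≈ (id m p es) e = id m p (ess-≈ es e) , refl
derivation-≈ (⊥L C eq) e = ⊥L C (≈-trans (≈-sym e) eq) , refl
derivation-≈ ⊤R e = ⊤R , refl
derivation-≈ (⊤*R m es) e = ⊤*R m (ess-≈ es e) , refl
derivation-≈ (∧L C F G eq d) e = ∧L C F G (≈-trans (≈-sym e) eq) d , refl
derivation-≈ (∧R d d₁) e with derivation-≈ d e | derivation-≈ d₁ e
... | a , p | b , q = ∧R a b , cong₂ (λ u v → suc (u ⊔ v)) p q
derivation-≈ (∨L C F G eq d d₁) e = ∨L C F G (≈-trans (≈-sym e) eq) d d₁ , refl
derivation-≈ (∨R₁ d) e with derivation-≈ d e
... | a , p = ∨R₁ a , cong suc p
derivation-≈ (∨R₂ d) e with derivation-≈ d e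
... | a , p = ∨R₂ a , cong suc p
derivation-≈ (⊃L C m F G E es eq d d₁) e = ⊃L C m F G E es (≈-trans (≈-sym e) eq) d d₁ , refl
derivation-≈ (⊃R d) e with derivation-≈ d (；-cong e ≈-refl)
... | a , p = ⊃R a , cong suc p
derivation-≈ (✶L C F G eq d) e = ✶L C F G (≈-trans (≈-sym e) eq) d , refl
derivation-≈ (✶R₁₂ Re₁ Re₂ c d d₁) e = ✶R₁₂ Re₁ Re₂ (candidate-≈ c e) d d₁ , refl
derivation-≈ (✶R₂₁ Re₁ Re₂ c d d₁) e = ✶R₂₁ Re₁ Re₂ (candidate-≈ c e) d d₁ , refl
derivation-≈ (-✶L₁₂ C Γ' m F G E Re₁ Re₂ c es eq d d₁) e =
  -✶L₁₂ C Γ' m F G E Re₁ Re₂ c es (≈-trans (≈-sym e) eq) d d₁ , refl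
derivation-≈ (-✶L₂₁ C Γ' m F G E Re₁ Re₂ c es eq d d₁) e =
  -✶L₂₁ C Γ' m F G E Re₁ Re₂ c es (≈-trans (≈-sym e) eq) d d₁ , refl
derivation-≈ (-✶L₀ C m F G E es eq d d₁) e = -✶L₀ C m F G E es (≈-trans (≈-sym e) eq) d d₁ , refl
derivation-≈ (-✶R d) e with derivation-≈ d (，-cong e ≈-refl)
... | a , p = -✶R a , cong suc p

derivable-≈ : ∀ {n A B H} → A ≈ B → DerivableIn n A H → DerivableIn n B H
derivable-≈ e (d , le) with derivation-≈ d e
... | d' , p = d' , subst (_≤ _) (sym p) le

derivable-suc : ∀ {n A H} → DerivableIn n A H → DerivableIn (suc n) A H
derivable-suc (d , le) = d , m≤n⇒m≤1+n le

premise₁ : ∀ {n b A F} (d : Deriv A F) → depth d ⊔ b ≤ n → DerivableIn n A F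
premise₁ d le = d , ⊔≤ˡ le

premise₂ : ∀ {n a A F} (d : Deriv A F) → a ⊔ depth d ≤ n → DerivableIn n A F
premise₂ d le = d , ⊔≤ʳ le

module _ {n : ℕ} where

  ∧L≤ : ∀ {Γ H} C F G → Γ ≈ C [ ⌊ F ∧ᶠ G ⌋ ] →
        DerivableIn n (C [ ⌊ F ⌋ ； ⌊ G ⌋ ]) H → DerivableIn (suc n) Γ H
  ∧L≤ C F G eq (d , le) = ∧L C F G eq d , s≤s le

  ∨L≤ : ∀ {Γ H} C F G → Γ ≈ C [ ⌊ F ∨ᶠ G ⌋ ] →
        DerivableIn n (C [ ⌊ F ⌋ ]) H → DerivableIn n (C [ ⌊ G ⌋ ]) H → DerivableIn (suc n) Γ H
  ∨L≤ C F G eq (d , p) (e , q) = ∨L C F G eq d e , binary≤ p q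

  ⊃L≤ : ∀ {Γ H} C m F G E → Ess (m ；? ⌊ F ⊃ G ⌋) E → Γ ≈ C [ E ] →
        DerivableIn n E F → DerivableIn n (C [ ⌊ G ⌋ ； E ]) H → DerivableIn (suc n) Γ H
  ⊃L≤ C m F G E es eq (d , p) (e , q) = ⊃L C m F G E es eq d e , binary≤ p q

  ✶L≤ : ∀ {Γ H} C F G → Γ ≈ C [ ⌊ F ✶ G ⌋ ] →
        DerivableIn n (C [ ⌊ F ⌋ ， ⌊ G ⌋ ]) H → DerivableIn (suc n) Γ H
  ✶L≤ C F G eq (d , le) = ✶L C F G eq d , s≤s le

  -✶L₁₂≤ : ∀ {Γ H} C Γ' m F G E Re₁ Re₂ → Candidate Γ' Re₁ Re₂ →
           Ess (m ；? ⌊ F -✶ G ⌋) E → Γ ≈ C [ Γ' ， E ] →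
           DerivableIn n Re₁ F → DerivableIn n (C [ (Re₂ ， ⌊ G ⌋) ； (Γ' ， E) ]) H →
           DerivableIn (suc n) Γ H
  -✶L₁₂≤ C Γ' m F G E Re₁ Re₂ c es eq (d , p) (e , q) =
    -✶L₁₂ C Γ' m F G E Re₁ Re₂ c es eq d e , binary≤ p q

  -✶L₂₁≤ : ∀ {Γ H} C Γ' m F G E Re₁ Re₂ → Candidate Γ' Re₁ Re₂ →
           Ess (m ；? ⌊ F -✶ G ⌋) E → Γ ≈ C [ Γ' ， E ] →
           DerivableIn n Re₂ F → DerivableIn n (C [ (Re₁ ， ⌊ G ⌋) ； (Γ' ， E) ]) H →
           DerivableIn (suc n) Γ H
  -✶L₂₁≤ C Γ' m F G E Re₁ Re₂ c es eq (d , p) (e , q) =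
    -✶L₂₁ C Γ' m F G E Re₁ Re₂ c es eq d e , binary≤ p q

  -✶L₀≤ : ∀ {Γ H} C m F G E → Ess (m ；? ⌊ F -✶ G ⌋) E → Γ ≈ C [ E ] →
          DerivableIn n ⌊ ⊤* ⌋ F → DerivableIn n (C [ ⌊ G ⌋ ； E ]) H → DerivableIn (suc n) Γ H
  -✶L₀≤ C m F G E es eq (d , p) (e , q) = -✶L₀ C m F G E es eq d e , binary≤ p q

  ∧R≤ : ∀ {Γ F G} → DerivableIn n Γ F → DerivableIn n Γ G → DerivableIn (suc n) Γ (F ∧ᶠ G)
  ∧R≤ (d , p) (e , q) = ∧R d e , binary≤ p q

  ∨R₁≤ : ∀ {Γ F G} → DerivableIn n Γ F → DerivableIn (suc n) Γ (F ∨ᶠ G)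
  ∨R₁≤ (d , le) = ∨R₁ d , s≤s le

  ∨R₂≤ : ∀ {Γ F G} → DerivableIn n Γ G → DerivableIn (suc n) Γ (F ∨ᶠ G)
  ∨R₂≤ (d , le) = ∨R₂ d , s≤s le

  ⊃R≤ : ∀ {Γ F G} → DerivableIn n (Γ ； ⌊ F ⌋) G → DerivableIn (suc n) Γ (F ⊃ G)
  ⊃R≤ (d , le) = ⊃R d , s≤s le

  ✶R₁₂≤ : ∀ {Γ F₁ F₂} Re₁ Re₂ → Candidate Γ Re₁ Re₂ →
          DerivableIn n Re₁ F₁ → DerivableIn n Re₂ F₂ → DerivableIn (suc n) Γ (F₁ ✶ F₂)
  ✶R₁₂≤ Re₁ Re₂ c (d , p) (e , q) = ✶R₁₂ Re₁ Re₂ c d e , binary≤ p q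

  ✶R₂₁≤ : ∀ {Γ F₁ F₂} Re₁ Re₂ → Candidate Γ Re₁ Re₂ →
          DerivableIn n Re₂ F₁ → DerivableIn n Re₁ F₂ → DerivableIn (suc n) Γ (F₁ ✶ F₂)
  ✶R₂₁≤ Re₁ Re₂ c (d , p) (e , q) = ✶R₂₁ Re₁ Re₂ c d e , binary≤ p q

  -✶R≤ : ∀ {Γ F G} → DerivableIn n (Γ ， ⌊ F ⌋) G → DerivableIn (suc n) Γ (F -✶ G)
  -✶R≤ (d , le) = -✶R d , s≤s le

-- The rules ✶R₁₂/✶R₂₁ and -✶L₁₂/-✶L₂₁ differ only in the order of the
-- candidate pair, so we also use them with a candidate pair up to order.
Candidate± : Str → Str → Str → Set
Candidate± S R₁ R₂ = Candidate S R₁ R₂ ⊎ Candidate S R₂ R₁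

candidate±-⊤* : ∀ {R₁ R₂} → Candidate± ⌊ ⊤* ⌋ R₁ R₂ → (R₁ ≡ ⌊ ⊤* ⌋) × (R₂ ≡ ⌊ ⊤* ⌋)
candidate±-⊤* (inj₁ c) = candidate-⊤* c
candidate±-⊤* (inj₂ c) = let (p , p') = candidate-⊤* c in p' , p

✶R±≤ : ∀ {n Γ F₁ F₂ R₁ R₂} → Candidate± Γ R₁ R₂ →
       DerivableIn n R₁ F₁ → DerivableIn n R₂ F₂ → DerivableIn (suc n) Γ (F₁ ✶ F₂)
✶R±≤ (inj₁ c) = ✶R₁₂≤ _ _ c
✶R±≤ (inj₂ c) = ✶R₂₁≤ _ _ c

-✶L±≤ : ∀ {n Γ H} C Γ' m F G E {Rᵢ Rⱼ} → Candidate± Γ' Rᵢ Rⱼ →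
        Ess (m ；? ⌊ F -✶ G ⌋) E → Γ ≈ C [ Γ' ， E ] →
        DerivableIn n Rᵢ F → DerivableIn n (C [ (Rⱼ ， ⌊ G ⌋) ； (Γ' ， E) ]) H →
        DerivableIn (suc n) Γ H
-✶L±≤ C Γ' m F G E (inj₁ c) = -✶L₁₂≤ C Γ' m F G E _ _ c
-✶L±≤ C Γ' m F G E (inj₂ c) = -✶L₂₁≤ C Γ' m F G E _ _ c

Admissible : ℕ → (Str → Str → Set) → Set
Admissible n R = ∀ {A B H} → R A B → DerivableIn n A H → DerivableIn n B H

_⁼ : (Str → Str → Set) → Str → Str → Set
(R ⁼) A B = A ≡ B ⊎ R A B

admissible-⁼ : ∀ {n R} → Admissible n R → Admissible n (R ⁼)
admissible-⁼ adm (inj₁ refl) x = x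
admissible-⁼ adm (inj₂ r) x = adm r x

⁼-map : ∀ (R : Str → Str → Set) (f : Str → Str) → (∀ {A B} → R A B → R (f A) (f B)) →
        ∀ {A B} → (R ⁼) A B → (R ⁼) (f A) (f B)
⁼-map R f g (inj₁ refl) = inj₁ refl
⁼-map R f g (inj₂ r) = inj₂ (g r)

data Replace (L : Formula) (Y : Str) : Str → Str → Set where
  here : ∀ {f} → f ≡ L → Replace L Y ⌊ f ⌋ Y
  ；₁  : ∀ {A A' B} → Replace L Y A A' → Replace L Y (A ； B) (A' ； B)
  ；₂  : ∀ {A B B'} → Replace L Y B B' → Replace L Y (A ； B) (A ； B')
  ，₁  : ∀ {A A' B} → Replace L Y A A' → Replace L Y (A ， B) (A' ， B)
  ，₂  : ∀ {A B B'} → Replace L Y B B' → Replace L Y (A ， B) (A ， B')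

data ReplaceCtx (L : Formula) (Y : Str) : Ctx → Ctx → Set where
  ；ˡ-ctx : ∀ {C C' B} → ReplaceCtx L Y C C' → ReplaceCtx L Y (C ；ˡ B) (C' ；ˡ B)
  ；ˡ-str : ∀ {C B B'} → Replace L Y B B' → ReplaceCtx L Y (C ；ˡ B) (C ；ˡ B')
  ；ʳ-ctx : ∀ {C C' B} → ReplaceCtx L Y C C' → ReplaceCtx L Y (B ；ʳ C) (B ；ʳ C')
  ；ʳ-str : ∀ {C B B'} → Replace L Y B B' → ReplaceCtx L Y (B ；ʳ C) (B' ；ʳ C)
  ，ˡ-ctx : ∀ {C C' B} → ReplaceCtx L Y C C' → ReplaceCtx L Y (C ，ˡ B) (C' ，ˡ B)
  ，ˡ-str : ∀ {C B B'} → Replace L Y B B' → ReplaceCtx L Y (C ，ˡ B) (C ，ˡ B')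
  ，ʳ-ctx : ∀ {C C' B} → ReplaceCtx L Y C C' → ReplaceCtx L Y (B ，ʳ C) (B ，ʳ C')
  ，ʳ-str : ∀ {C B B'} → Replace L Y B B' → ReplaceCtx L Y (B ，ʳ C) (B' ，ʳ C)

module ReplaceProperties {L : Formula} {Y : Str} where

  replace-ctx : ∀ {C C'} X → ReplaceCtx L Y C C' → Replace L Y (C [ X ]) (C' [ X ])
  replace-ctx X (；ˡ-ctx r) = ；₁ (replace-ctx X r)
  replace-ctx X (；ˡ-str r) = ；₂ r
  replace-ctx X (；ʳ-ctx r) = ；₂ (replace-ctx X r)
  replace-ctx X (；ʳ-str r) = ；₁ r
  replace-ctx X (，ˡ-ctx r) = ，₁ (replace-ctx X r)
  replace-ctx X (，ˡ-str r) = ，₂ r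
  replace-ctx X (，ʳ-ctx r) = ，₂ (replace-ctx X r)
  replace-ctx X (，ʳ-str r) = ，₁ r

  replace-hole : ∀ C {X X'} → Replace L Y X X' → Replace L Y (C [ X ]) (C [ X' ])
  replace-hole ─ r = r
  replace-hole (C ；ˡ _) r = ；₁ (replace-hole C r)
  replace-hole (_ ；ʳ C) r = ；₂ (replace-hole C r)
  replace-hole (C ，ˡ _) r = ，₁ (replace-hole C r)
  replace-hole (_ ，ʳ C) r = ，₂ (replace-hole C r)

  data Split (C : Ctx) (X : Str) : Str → Set where
    in-ctx  : ∀ {C'} → ReplaceCtx L Y C C' → Split C X (C' [ X ])
    in-hole : ∀ {X'} → Replace L Y X X' → Split C X (C [ X' ])

  split : ∀ C {X T} → Replace L Y (C [ X ]) T → Split C X T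
  split ─ r = in-hole r
  split (C ；ˡ B) (；₁ r) with split C r
  ... | in-ctx rc = in-ctx (；ˡ-ctx rc)
  ... | in-hole r' = in-hole r'
  split (C ；ˡ B) (；₂ r) = in-ctx (；ˡ-str r)
  split (B ；ʳ C) (；₂ r) with split C r
  ... | in-ctx rc = in-ctx (；ʳ-ctx rc)
  ... | in-hole r' = in-hole r'
  split (B ；ʳ C) (；₁ r) = in-ctx (；ʳ-str r)
  split (C ，ˡ B) (，₁ r) with split C r
  ... | in-ctx rc = in-ctx (，ˡ-ctx rc)
  ... | in-hole r' = in-hole r'
  split (C ，ˡ B) (，₂ r) = in-ctx (，ˡ-str r)
  split (B ，ʳ C) (，₂ r) with split C r
  ... | in-ctx rc = in-ctx (，ʳ-ctx rc)
  ... | in-hole r' = in-hole r'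
  split (B ，ʳ C) (，₁ r) = in-ctx (，ʳ-str r)

  Transports : Str → Str → Set
  Transports A B = ∀ {A'} → Replace L Y A A' → Σ Str λ B' → Replace L Y B B' × A' ≈ B'

  transport : ∀ {A B} → A ≈ B → Transports A B × Transports B A
  transport ≈-refl = (λ r → _ , r , ≈-refl) , (λ r → _ , r , ≈-refl)
  transport (≈-sym e) = proj₂ (transport e) , proj₁ (transport e)
  transport (≈-trans e f) = compose (proj₁ (transport e)) (proj₁ (transport f)) ,
                            compose (proj₂ (transport f)) (proj₂ (transport e))
    where
    compose : ∀ {A B C} → Transports A B → Transports B C → Transports A C
    compose t u r = let (_ , r₁ , q₁) = t r ; (_ , r₂ , q₂) = u r₁ in _ , r₂ , ≈-trans q₁ q₂
  transport (；-cong e f) = fw , bw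
    where
    fw : Transports _ _
    fw (；₁ r) = let (_ , r₁ , q) = proj₁ (transport e) r in _ , ；₁ r₁ , ；-cong q f
    fw (；₂ r) = let (_ , r₁ , q) = proj₁ (transport f) r in _ , ；₂ r₁ , ；-cong e q
    bw : Transports _ _
    bw (；₁ r) = let (_ , r₁ , q) = proj₂ (transport e) r in _ , ；₁ r₁ , ；-cong q (≈-sym f)
    bw (；₂ r) = let (_ , r₁ , q) = proj₂ (transport f) r in _ , ；₂ r₁ , ；-cong (≈-sym e) q
  transport (，-cong e f) = fw , bw
    where
    fw : Transports _ _
    fw (，₁ r) = let (_ , r₁ , q) = proj₁ (transport e) r in _ , ，₁ r₁ , ，-cong q f
    fw (，₂ r) = let (_ , r₁ , q) = proj₁ (transport f) r in _ , ，₂ r₁ , ，-cong e q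
    bw : Transports _ _
    bw (，₁ r) = let (_ , r₁ , q) = proj₂ (transport e) r in _ , ，₁ r₁ , ，-cong q (≈-sym f)
    bw (，₂ r) = let (_ , r₁ , q) = proj₂ (transport f) r in _ , ，₂ r₁ , ，-cong (≈-sym e) q
  transport ；-assoc = fw , bw
    where
    fw : Transports _ _
    fw (；₁ (；₁ r)) = _ , ；₁ r , ；-assoc
    fw (；₁ (；₂ r)) = _ , ；₂ (；₁ r) , ；-assoc
    fw (；₂ r) = _ , ；₂ (；₂ r) , ；-assoc
    bw : Transports _ _
    bw (；₁ r) = _ , ；₁ (；₁ r) , ≈-sym ；-assoc
    bw (；₂ (；₁ r)) = _ , ；₁ (；₂ r) , ≈-sym ；-assoc
    bw (；₂ (；₂ r)) = _ , ；₂ r , ≈-sym ；-assoc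
  transport ；-comm = commute , commute
    where
    commute : ∀ {A B} → Transports (A ； B) (B ； A)
    commute (；₁ r) = _ , ；₂ r , ；-comm
    commute (；₂ r) = _ , ；₁ r , ；-comm
  transport ，-assoc = fw , bw
    where
    fw : Transports _ _
    fw (，₁ (，₁ r)) = _ , ，₁ r , ，-assoc
    fw (，₁ (，₂ r)) = _ , ，₂ (，₁ r) , ，-assoc
    fw (，₂ r) = _ , ，₂ (，₂ r) , ，-assoc
    bw : Transports _ _
    bw (，₁ r) = _ , ，₁ (，₁ r) , ≈-sym ，-assoc
    bw (，₂ (，₁ r)) = _ , ，₁ (，₂ r) , ≈-sym ，-assoc
    bw (，₂ (，₂ r)) = _ , ，₂ r , ≈-sym ，-assoc
  transport ，-comm = commute , commute
    where
    commute : ∀ {A B} → Transports (A ， B) (B ， A)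
    commute (，₁ r) = _ , ，₂ r , ，-comm
    commute (，₂ r) = _ , ，₁ r , ，-comm

  data Located (C : Ctx) (X : Str) (Γ' : Str) : Set where
    in-ctx  : ∀ {C'} → ReplaceCtx L Y C C' → Γ' ≈ C' [ X ] → Located C X Γ'
    in-hole : ∀ {X'} → Replace L Y X X' → Γ' ≈ C [ X' ] → Located C X Γ'

  locate : ∀ {Γ Γ' C X} → Γ ≈ C [ X ] → Replace L Y Γ Γ' → Located C X Γ'
  locate {C = C} eq r with proj₁ (transport eq) r
  ... | _ , r₁ , q with split C r₁
  ... | in-ctx rc = in-ctx rc q
  ... | in-hole r' = in-hole r' q

  -- A replacement inside an essence of Γ₁ happens either inside Γ₁ itself
  -- or inside one of the added units ⊤*; the latter only matters when L is
  -- ⊤*, and then, provided Y has the shape Z ; ⊤*, the result is again an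
  -- essence of Γ₁ (the unit part absorbs Z additively).
  replace-essence : (L ≡ ⊤* → Σ Str λ Z → Y ≡ Z ； ⌊ ⊤* ⌋) →
                    ∀ {Γ₁ Δ Δ'} → Essence Γ₁ Δ → Replace L Y Δ Δ' →
                    (Σ Str λ Γ₁' → Replace L Y Γ₁ Γ₁' × Essence Γ₁' Δ') ⊎ Essence Γ₁ Δ'
  replace-essence unit e-self r = inj₁ (_ , r , e-self)
  replace-essence unit (e-≈ e x) r with proj₂ (transport x) r
  ... | _ , r₁ , q with replace-essence unit e r₁
  ... | inj₁ (g , rg , e') = inj₁ (g , rg , e-≈ e' (≈-sym q))
  ... | inj₂ e' = inj₂ (e-≈ e' (≈-sym q))
  replace-essence unit (e-ii C Γ' Γ₂ e) r with split C r
  ... | in-ctx rc with replace-essence unit e (replace-ctx Γ' rc)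
  ... | inj₁ (g , rg , e') = inj₁ (g , rg , e-ii _ Γ' Γ₂ e')
  ... | inj₂ e' = inj₂ (e-ii _ Γ' Γ₂ e')
  replace-essence unit (e-ii C Γ' Γ₂ e) r | in-hole (，₁ r') with replace-essence unit e (replace-hole C r')
  ... | inj₁ (g , rg , e') = inj₁ (g , rg , e-ii C _ Γ₂ e')
  ... | inj₂ e' = inj₂ (e-ii C _ Γ₂ e')
  replace-essence unit (e-ii C Γ' nothing e) r | in-hole (，₂ (here p)) with unit (sym p)
  ... | Z , refl = inj₂ (e-ii C Γ' (just Z) e)
  replace-essence unit (e-ii C Γ' (just G) e) r | in-hole (，₂ (；₁ r')) = inj₂ (e-ii C Γ' (just _) e)
  replace-essence unit (e-ii C Γ' (just G) e) r | in-hole (，₂ (；₂ (here p))) with unit (sym p)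
  ... | Z , refl = inj₂ (e-≈ (e-ii C Γ' (just (G ； Z)) e) (plug-cong C (，-cong ≈-refl ；-assoc)))

  replace-head : ∀ {m P X} → (L ≡ P → Σ Str λ Z → Y ≡ Z ； ⌊ P ⌋) → Replace L Y (m ；? ⌊ P ⌋) X →
                 Σ (Maybe Str) λ m' → X ≈ (m' ；? ⌊ P ⌋)
  replace-head {nothing} same (here p) with same (sym p)
  ... | Z , refl = just Z , ≈-refl
  replace-head {just _} same (；₁ r) = just _ , ≈-refl
  replace-head {just x} same (；₂ (here p)) with same (sym p)
  ... | Z , refl = just (x ； Z) , ≈-sym ；-assoc

  essence-step : ∀ {m P E E'} → L ≢ ⊤* → L ≢ P → Ess (m ；? ⌊ P ⌋) E → Replace L Y E E' →
                 Σ (Maybe Str) λ m' → Ess (m' ；? ⌊ P ⌋) E'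
  essence-step {m} not⊤* notP e r with replace-essence (λ x → ⊥-elim (not⊤* x)) (toEssence e) r
  ... | inj₂ e' = m , fromEssence e'
  ... | inj₁ (_ , rg , e') with replace-head (λ x → ⊥-elim (notP x)) rg
  ... | m' , q = m' , fromEssence (essence-base-≈ e' q)

  replace-⪯ : ∀ {X S S'} → X ⪯ S → Replace L Y S S' →
              (X ⪯ S') ⊎ (Σ Str λ X' → Replace L Y X X' × X' ⪯ S')
  replace-⪯ (⪯-≈ x) r with proj₂ (transport x) r
  ... | _ , r₁ , q = inj₂ (_ , r₁ , ⪯-≈ (≈-sym q))
  replace-⪯ (⪯-trans p q) r with replace-⪯ q r
  ... | inj₁ q' = inj₁ (⪯-trans p q')
  ... | inj₂ (_ , rm , q') with replace-⪯ p rm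
  ... | inj₁ p' = inj₁ (⪯-trans p' q')
  ... | inj₂ (X' , rx , p') = inj₂ (X' , rx , ⪯-trans p' q')
  replace-⪯ (⪯-weak C G G') r with split C r
  ... | in-ctx rc = inj₂ (_ , replace-ctx G rc , ⪯-weak _ G G')
  ... | in-hole (；₁ r') = inj₂ (_ , replace-hole C r' , ⪯-weak C _ G')
  ... | in-hole (；₂ r') = inj₁ (⪯-weak C G _)

  replace-candidate : ∀ {S S' R₁ R₂} → Candidate S R₁ R₂ → Replace L Y S S' →
                      Σ Str λ R₁' → Σ Str λ R₂' →
                      Candidate S' R₁' R₂' × (Replace L Y ⁼) R₁ R₁' × (Replace L Y ⁼) R₂ R₂'
  replace-candidate (cand-unit p) r with replace-⪯ p r
  ... | inj₁ p' = _ , _ , cand-unit p' , inj₁ refl , inj₁ refl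
  ... | inj₂ (_ , rx , p') = _ , _ , cand-unit p' , inj₂ rx , inj₁ refl
  replace-candidate (cand-pair p) r with replace-⪯ p r
  ... | inj₁ p' = _ , _ , cand-pair p' , inj₁ refl , inj₁ refl
  ... | inj₂ (_ , ，₁ rx , p') = _ , _ , cand-pair p' , inj₂ rx , inj₁ refl
  ... | inj₂ (_ , ，₂ rx , p') = _ , _ , cand-pair p' , inj₁ refl , inj₂ rx

  replace-candidate± : ∀ {S S' R₁ R₂} → Candidate± S R₁ R₂ → Replace L Y S S' →
                       Σ Str λ R₁' → Σ Str λ R₂' →
                       Candidate± S' R₁' R₂' × (Replace L Y ⁼) R₁ R₁' × (Replace L Y ⁼) R₂ R₂'
  replace-candidate± (inj₁ c) r =
    let (R₁' , R₂' , c' , r₁ , r₂) = replace-candidate c r in R₁' , R₂' , inj₁ c' , r₁ , r₂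
  replace-candidate± (inj₂ c) r =
    let (R₂' , R₁' , c' , r₂ , r₁) = replace-candidate c r in R₁' , R₂' , inj₂ c' , r₁ , r₂

-- Which leaves may be replaced by what without increasing depth: a
-- principal formula of ∧L, ∨L or ✶L by (one of) its premise structures,
-- and ⊤ (which no rule decomposes) by anything.
data Replaceable : Formula → Str → Set where
  ∧-parts : ∀ {F G} → Replaceable (F ∧ᶠ G) (⌊ F ⌋ ； ⌊ G ⌋)
  ∨-part₁ : ∀ {F G} → Replaceable (F ∨ᶠ G) ⌊ F ⌋
  ∨-part₂ : ∀ {F G} → Replaceable (F ∨ᶠ G) ⌊ G ⌋
  ✶-parts : ∀ {F G} → Replaceable (F ✶ G) (⌊ F ⌋ ， ⌊ G ⌋)
  ⊤-any   : ∀ {Y} → Replaceable ⊤ᶠ Y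

-- Formulas whose left occurrences are never replaced: ⊥ and the formulas
-- heading the essences of the axioms and of ⊃L, -✶L.
data Rigid : Formula → Set where
  var-rigid : ∀ {p} → Rigid (var p)
  ⊥-rigid   : Rigid ⊥ᶠ
  ⊤*-rigid  : Rigid ⊤*
  ⊃-rigid   : ∀ {F G} → Rigid (F ⊃ G)
  -✶-rigid  : ∀ {F G} → Rigid (F -✶ G)

rigid-not-replaceable : ∀ {L P Y} → Replaceable L Y → Rigid P → L ≢ P
rigid-not-replaceable ∧-parts () refl
rigid-not-replaceable ∨-part₁ () refl
rigid-not-replaceable ∨-part₂ () refl
rigid-not-replaceable ✶-parts () refl
rigid-not-replaceable ⊤-any () refl

principal-∧ : ∀ {n L Y F G H} C → F ∧ᶠ G ≡ L → Replaceable L Y →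
              DerivableIn n (C [ ⌊ F ⌋ ； ⌊ G ⌋ ]) H → DerivableIn (suc n) (C [ Y ]) H
principal-∧ C refl ∧-parts d = derivable-suc d

principal-∨ : ∀ {n L Y F G H} C → F ∨ᶠ G ≡ L → Replaceable L Y →
              DerivableIn n (C [ ⌊ F ⌋ ]) H → DerivableIn n (C [ ⌊ G ⌋ ]) H →
              DerivableIn (suc n) (C [ Y ]) H
principal-∨ C refl ∨-part₁ d e = derivable-suc d
principal-∨ C refl ∨-part₂ d e = derivable-suc e

principal-✶ : ∀ {n L Y F G H} C → F ✶ G ≡ L → Replaceable L Y →
              DerivableIn n (C [ ⌊ F ⌋ ， ⌊ G ⌋ ]) H → DerivableIn (suc n) (C [ Y ]) H
principal-✶ C refl ✶-parts d = derivable-suc d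

module Replacement {L : Formula} {Y : Str} (rep : Replaceable L Y) where
  open ReplaceProperties {L} {Y}

  -- the head formula of an essence is rigid, so it is not the replaced leaf
  essence-replaced : ∀ {m P E E'} → Rigid P → Ess (m ；? ⌊ P ⌋) E → Replace L Y E E' →
                     Σ (Maybe Str) λ m' → Ess (m' ；? ⌊ P ⌋) E'
  essence-replaced rigid =
    essence-step (rigid-not-replaceable rep ⊤*-rigid) (rigid-not-replaceable rep rigid)

  replace-residue : ∀ C {A B} G W → (Replace L Y ⁼) A B →
                    (Replace L Y ⁼) (C [ (A ， ⌊ G ⌋) ； W ]) (C [ (B ， ⌊ G ⌋) ； W ])
  replace-residue C G W =
    ⁼-map (Replace L Y) (λ A → C [ (A ， ⌊ G ⌋) ； W ]) (λ x → replace-hole C (；₁ (，₁ x)))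

  replace : ∀ n → Admissible n (Replace L Y)
  replace⁼ : ∀ n → Admissible n (Replace L Y ⁼)
  replace-✶R : ∀ n {Γ Γ₀ F₁ F₂ R₁ R₂} → Candidate± Γ R₁ R₂ → Replace L Y Γ Γ₀ →
               DerivableIn n R₁ F₁ → DerivableIn n R₂ F₂ → DerivableIn (suc n) Γ₀ (F₁ ✶ F₂)
  replace--✶L : ∀ n {Γ Γ₀ H} C Γ' m F G E {Rᵢ Rⱼ} → Candidate± Γ' Rᵢ Rⱼ →
                Ess (m ；? ⌊ F -✶ G ⌋) E → Γ ≈ C [ Γ' ， E ] → Replace L Y Γ Γ₀ →
                DerivableIn n Rᵢ F → DerivableIn n (C [ (Rⱼ ， ⌊ G ⌋) ； (Γ' ， E) ]) H →
                DerivableIn (suc n) Γ₀ H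

  replace-✶R n c r d₁ d₂ =
    let (R₁' , R₂' , c' , r₁ , r₂) = replace-candidate± c r in
    ✶R±≤ c' (replace⁼ n r₁ d₁) (replace⁼ n r₂ d₂)

  replace--✶L n C Γ' m F G E c e eq r d₁ d₂ with locate eq r
  ... | in-ctx rc q = -✶L±≤ _ Γ' m F G E c e q d₁ (replace n (replace-ctx _ rc) d₂)
  ... | in-hole (，₂ re) q =
    let (m' , e') = essence-replaced -✶-rigid e re in
    -✶L±≤ C Γ' m' F G _ c e' q d₁ (replace n (replace-hole C (；₂ (，₂ re))) d₂)
  ... | in-hole (，₁ rg) q =
    let (Rᵢ' , Rⱼ' , c' , rᵢ , rⱼ) = replace-candidate± c rg in
    -✶L±≤ C _ m F G E c' e q (replace⁼ n rᵢ d₁)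
      (replace⁼ n (replace-residue C G _ rⱼ) (replace n (replace-hole C (；₂ (，₁ rg))) d₂))

  replace n r (id m p e , le) = let (m' , e') = essence-replaced var-rigid e r in id m' p e' , le
  replace n r (⊥L C eq , le) with locate eq r
  ... | in-ctx _ q = ⊥L _ q , le
  ... | in-hole (here p) q = ⊥-elim (rigid-not-replaceable rep ⊥-rigid (sym p))
  replace n r (⊤R , le) = ⊤R , le
  replace n r (⊤*R m e , le) = let (m' , e') = essence-replaced ⊤*-rigid e r in ⊤*R m' e' , le
  replace (suc n) r (∧L C F G eq d , s≤s le) with locate eq r
  ... | in-ctx rc q = ∧L≤ _ F G q (replace n (replace-ctx _ rc) (d , le))
  ... | in-hole (here p) q = derivable-≈ (≈-sym q) (principal-∧ C p rep (d , le))
  replace (suc n) r (∧R d₁ d₂ , s≤s le) =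
    ∧R≤ (replace n r (premise₁ d₁ le)) (replace n r (premise₂ d₂ le))
  replace (suc n) r (∨L C F G eq d₁ d₂ , s≤s le) with locate eq r
  ... | in-ctx rc q =
    ∨L≤ _ F G q (replace n (replace-ctx _ rc) (premise₁ d₁ le)) (replace n (replace-ctx _ rc) (premise₂ d₂ le))
  ... | in-hole (here p) q =
    derivable-≈ (≈-sym q) (principal-∨ C p rep (premise₁ d₁ le) (premise₂ d₂ le))
  replace (suc n) r (∨R₁ d , s≤s le) = ∨R₁≤ (replace n r (d , le))
  replace (suc n) r (∨R₂ d , s≤s le) = ∨R₂≤ (replace n r (d , le))
  replace (suc n) r (⊃L C m F G E e eq d₁ d₂ , s≤s le) with locate eq r
  ... | in-ctx rc q = ⊃L≤ _ m F G E e q (premise₁ d₁ le) (replace n (replace-ctx _ rc) (premise₂ d₂ le))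
  ... | in-hole re q =
    let (m' , e') = essence-replaced ⊃-rigid e re in
    ⊃L≤ C m' F G _ e' q (replace n re (premise₁ d₁ le)) (replace n (replace-hole C (；₂ re)) (premise₂ d₂ le))
  replace (suc n) r (⊃R d , s≤s le) = ⊃R≤ (replace n (；₁ r) (d , le))
  replace (suc n) r (✶L C F G eq d , s≤s le) with locate eq r
  ... | in-ctx rc q = ✶L≤ _ F G q (replace n (replace-ctx _ rc) (d , le))
  ... | in-hole (here p) q = derivable-≈ (≈-sym q) (principal-✶ C p rep (d , le))
  replace (suc n) r (✶R₁₂ R₁ R₂ c d₁ d₂ , s≤s le) = replace-✶R n (inj₁ c) r (premise₁ d₁ le) (premise₂ d₂ le)
  replace (suc n) r (✶R₂₁ R₁ R₂ c d₁ d₂ , s≤s le) = replace-✶R n (inj₂ c) r (premise₁ d₁ le) (premise₂ d₂ le)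
  replace (suc n) r (-✶L₁₂ C Γ' m F G E R₁ R₂ c e eq d₁ d₂ , s≤s le) =
    replace--✶L n C Γ' m F G E (inj₁ c) e eq r (premise₁ d₁ le) (premise₂ d₂ le)
  replace (suc n) r (-✶L₂₁ C Γ' m F G E R₁ R₂ c e eq d₁ d₂ , s≤s le) =
    replace--✶L n C Γ' m F G E (inj₂ c) e eq r (premise₁ d₁ le) (premise₂ d₂ le)
  replace (suc n) r (-✶L₀ C m F G E e eq d₁ d₂ , s≤s le) with locate eq r
  ... | in-ctx rc q = -✶L₀≤ _ m F G E e q (premise₁ d₁ le) (replace n (replace-ctx _ rc) (premise₂ d₂ le))
  ... | in-hole re q =
    let (m' , e') = essence-replaced -✶-rigid e re in
    -✶L₀≤ C m' F G _ e' q (premise₁ d₁ le) (replace n (replace-hole C (；₂ re)) (premise₂ d₂ le))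
  replace (suc n) r (-✶R d , s≤s le) = -✶R≤ (replace n (，₁ r) (d , le))

  replace⁼ n = admissible-⁼ (replace n)

data Drop⊤ : Str → Str → Set where
  drop₁ : ∀ {U A} → U ≡ ⌊ ⊤ᶠ ⌋ → Drop⊤ (U ； A) A
  drop₂ : ∀ {A U} → U ≡ ⌊ ⊤ᶠ ⌋ → Drop⊤ (A ； U) A
  ；₁   : ∀ {A A' B} → Drop⊤ A A' → Drop⊤ (A ； B) (A' ； B)
  ；₂   : ∀ {A B B'} → Drop⊤ B B' → Drop⊤ (A ； B) (A ； B')
  ，₁   : ∀ {A A' B} → Drop⊤ A A' → Drop⊤ (A ， B) (A' ， B)
  ，₂   : ∀ {A B B'} → Drop⊤ B B' → Drop⊤ (A ， B) (A ， B')

data Drop⊤Ctx : Ctx → Ctx → Set where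
  drop-sibling₁ : ∀ {U C} → U ≡ ⌊ ⊤ᶠ ⌋ → Drop⊤Ctx (U ；ʳ C) C
  drop-sibling₂ : ∀ {U C} → U ≡ ⌊ ⊤ᶠ ⌋ → Drop⊤Ctx (C ；ˡ U) C
  ；ˡ-ctx : ∀ {C C' B} → Drop⊤Ctx C C' → Drop⊤Ctx (C ；ˡ B) (C' ；ˡ B)
  ；ˡ-str : ∀ {C B B'} → Drop⊤ B B' → Drop⊤Ctx (C ；ˡ B) (C ；ˡ B')
  ；ʳ-ctx : ∀ {C C' B} → Drop⊤Ctx C C' → Drop⊤Ctx (B ；ʳ C) (B ；ʳ C')
  ；ʳ-str : ∀ {C B B'} → Drop⊤ B B' → Drop⊤Ctx (B ；ʳ C) (B' ；ʳ C)
  ，ˡ-ctx : ∀ {C C' B} → Drop⊤Ctx C C' → Drop⊤Ctx (C ，ˡ B) (C' ，ˡ B)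
  ，ˡ-str : ∀ {C B B'} → Drop⊤ B B' → Drop⊤Ctx (C ，ˡ B) (C ，ˡ B')
  ，ʳ-ctx : ∀ {C C' B} → Drop⊤Ctx C C' → Drop⊤Ctx (B ，ʳ C) (B ，ʳ C')
  ，ʳ-str : ∀ {C B B'} → Drop⊤ B B' → Drop⊤Ctx (B ，ʳ C) (B' ，ʳ C)

module Drop⊤Properties where

  drop-ctx : ∀ {C C'} X → Drop⊤Ctx C C' → Drop⊤ (C [ X ]) (C' [ X ])
  drop-ctx X (drop-sibling₁ p) = drop₁ p
  drop-ctx X (drop-sibling₂ p) = drop₂ p
  drop-ctx X (；ˡ-ctx r) = ；₁ (drop-ctx X r)
  drop-ctx X (；ˡ-str r) = ；₂ r
  drop-ctx X (；ʳ-ctx r) = ；₂ (drop-ctx X r)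
  drop-ctx X (；ʳ-str r) = ；₁ r
  drop-ctx X (，ˡ-ctx r) = ，₁ (drop-ctx X r)
  drop-ctx X (，ˡ-str r) = ，₂ r
  drop-ctx X (，ʳ-ctx r) = ，₂ (drop-ctx X r)
  drop-ctx X (，ʳ-str r) = ，₁ r

  drop-hole : ∀ C {X X'} → Drop⊤ X X' → Drop⊤ (C [ X ]) (C [ X' ])
  drop-hole ─ r = r
  drop-hole (C ；ˡ _) r = ；₁ (drop-hole C r)
  drop-hole (_ ；ʳ C) r = ；₂ (drop-hole C r)
  drop-hole (C ，ˡ _) r = ，₁ (drop-hole C r)
  drop-hole (_ ，ʳ C) r = ，₂ (drop-hole C r)

  data Split (C : Ctx) (X : Str) : Str → Set where
    in-ctx  : ∀ {C'} → Drop⊤Ctx C C' → Split C X (C' [ X ])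
    in-hole : ∀ {X'} → Drop⊤ X X' → Split C X (C [ X' ])
    is-unit : ∀ {T} → X ≡ ⌊ ⊤ᶠ ⌋ → Split C X T

  split : ∀ C {X T} → Drop⊤ (C [ X ]) T → Split C X T
  split ─ r = in-hole r
  split (C ；ˡ B) (drop₂ p) = in-ctx (drop-sibling₂ p)
  split (C ；ˡ B) (drop₁ p) = is-unit (proj₂ (plug-leaf C p))
  split (C ；ˡ B) (；₁ r) with split C r
  ... | in-ctx rc = in-ctx (；ˡ-ctx rc)
  ... | in-hole r' = in-hole r'
  ... | is-unit p = is-unit p
  split (C ；ˡ B) (；₂ r) = in-ctx (；ˡ-str r)
  split (B ；ʳ C) (drop₁ p) = in-ctx (drop-sibling₁ p)
  split (B ；ʳ C) (drop₂ p) = is-unit (proj₂ (plug-leaf C p))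
  split (B ；ʳ C) (；₂ r) with split C r
  ... | in-ctx rc = in-ctx (；ʳ-ctx rc)
  ... | in-hole r' = in-hole r'
  ... | is-unit p = is-unit p
  split (B ；ʳ C) (；₁ r) = in-ctx (；ʳ-str r)
  split (C ，ˡ B) (，₁ r) with split C r
  ... | in-ctx rc = in-ctx (，ˡ-ctx rc)
  ... | in-hole r' = in-hole r'
  ... | is-unit p = is-unit p
  split (C ，ˡ B) (，₂ r) = in-ctx (，ˡ-str r)
  split (B ，ʳ C) (，₂ r) with split C r
  ... | in-ctx rc = in-ctx (，ʳ-ctx rc)
  ... | in-hole r' = in-hole r'
  ... | is-unit p = is-unit p
  split (B ，ʳ C) (，₁ r) = in-ctx (，ʳ-str r)

  Transports : Str → Str → Set
  Transports A B = ∀ {A'} → Drop⊤ A A' → Σ Str λ B' → Drop⊤ B B' × A' ≈ B'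

  transport-；-cong : ∀ {A A' B B'} → A ≈ A' → B ≈ B' → Transports A A' → Transports B B' →
                      Transports (A ； B) (A' ； B')
  transport-；-cong e f tA tB (drop₁ refl) = _ , drop₁ (leaf-rigidʳ e) , f
  transport-；-cong e f tA tB (drop₂ refl) = _ , drop₂ (leaf-rigidʳ f) , e
  transport-；-cong e f tA tB (；₁ r) = let (_ , r' , q) = tA r in _ , ；₁ r' , ；-cong q f
  transport-；-cong e f tA tB (；₂ r) = let (_ , r' , q) = tB r in _ , ；₂ r' , ；-cong e q

  transport-，-cong : ∀ {A A' B B'} → A ≈ A' → B ≈ B' → Transports A A' → Transports B B' →
                      Transports (A ， B) (A' ， B')
  transport-，-cong e f tA tB (，₁ r) = let (_ , r' , q) = tA r in _ , ，₁ r' , ，-cong q f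
  transport-，-cong e f tA tB (，₂ r) = let (_ , r' , q) = tB r in _ , ，₂ r' , ，-cong e q

  transport : ∀ {A B} → A ≈ B → Transports A B × Transports B A
  transport ≈-refl = (λ r → _ , r , ≈-refl) , (λ r → _ , r , ≈-refl)
  transport (≈-sym e) = proj₂ (transport e) , proj₁ (transport e)
  transport (≈-trans e f) = compose (proj₁ (transport e)) (proj₁ (transport f)) ,
                            compose (proj₂ (transport f)) (proj₂ (transport e))
    where
    compose : ∀ {A B C} → Transports A B → Transports B C → Transports A C
    compose t u r = let (_ , r₁ , q₁) = t r ; (_ , r₂ , q₂) = u r₁ in _ , r₂ , ≈-trans q₁ q₂
  transport (；-cong e f) =
    transport-；-cong e f (proj₁ (transport e)) (proj₁ (transport f)) ,
    transport-；-cong (≈-sym e) (≈-sym f) (proj₂ (transport e)) (proj₂ (transport f))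
  transport (，-cong e f) =
    transport-，-cong e f (proj₁ (transport e)) (proj₁ (transport f)) ,
    transport-，-cong (≈-sym e) (≈-sym f) (proj₂ (transport e)) (proj₂ (transport f))
  transport ；-assoc = fw , bw
    where
    fw : Transports _ _
    fw (drop₂ p) = _ , ；₂ (drop₂ p) , ≈-refl
    fw (；₁ (drop₁ p)) = _ , drop₁ p , ≈-refl
    fw (；₁ (drop₂ p)) = _ , ；₂ (drop₁ p) , ≈-refl
    fw (；₁ (；₁ r)) = _ , ；₁ r , ；-assoc
    fw (；₁ (；₂ r)) = _ , ；₂ (；₁ r) , ；-assoc
    fw (；₂ r) = _ , ；₂ (；₂ r) , ；-assoc
    bw : Transports _ _
    bw (drop₁ p) = _ , ；₁ (drop₁ p) , ≈-refl
    bw (；₂ (drop₁ p)) = _ , ；₁ (drop₂ p) , ≈-refl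
    bw (；₂ (drop₂ p)) = _ , drop₂ p , ≈-refl
    bw (；₁ r) = _ , ；₁ (；₁ r) , ≈-sym ；-assoc
    bw (；₂ (；₁ r)) = _ , ；₁ (；₂ r) , ≈-sym ；-assoc
    bw (；₂ (；₂ r)) = _ , ；₂ r , ≈-sym ；-assoc
  transport ；-comm = commute , commute
    where
    commute : ∀ {A B} → Transports (A ； B) (B ； A)
    commute (drop₁ p) = _ , drop₂ p , ≈-refl
    commute (drop₂ p) = _ , drop₁ p , ≈-refl
    commute (；₁ r) = _ , ；₂ r , ；-comm
    commute (；₂ r) = _ , ；₁ r , ；-comm
  transport ，-assoc = fw , bw
    where
    fw : Transports _ _
    fw (，₁ (，₁ r)) = _ , ，₁ r , ，-assoc
    fw (，₁ (，₂ r)) = _ , ，₂ (，₁ r) , ，-assoc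
    fw (，₂ r) = _ , ，₂ (，₂ r) , ，-assoc
    bw : Transports _ _
    bw (，₁ r) = _ , ，₁ (，₁ r) , ≈-sym ，-assoc
    bw (，₂ (，₁ r)) = _ , ，₁ (，₂ r) , ≈-sym ，-assoc
    bw (，₂ (，₂ r)) = _ , ，₂ r , ≈-sym ，-assoc
  transport ，-comm = commute , commute
    where
    commute : ∀ {A B} → Transports (A ， B) (B ， A)
    commute (，₁ r) = _ , ，₂ r , ，-comm
    commute (，₂ r) = _ , ，₁ r , ，-comm

  data Located (C : Ctx) (X : Str) (Γ' : Str) : Set where
    in-ctx  : ∀ {C'} → Drop⊤Ctx C C' → Γ' ≈ C' [ X ] → Located C X Γ'
    in-hole : ∀ {X'} → Drop⊤ X X' → Γ' ≈ C [ X' ] → Located C X Γ'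
    is-unit : X ≡ ⌊ ⊤ᶠ ⌋ → Located C X Γ'

  locate : ∀ {Γ Γ' C X} → Γ ≈ C [ X ] → Drop⊤ Γ Γ' → Located C X Γ'
  locate {C = C} eq r with proj₁ (transport eq) r
  ... | _ , r₁ , q with split C r₁
  ... | in-ctx rc = in-ctx rc q
  ... | in-hole r' = in-hole r' q
  ... | is-unit p = is-unit p

  -- A deletion inside an essence of Γ₁ happens inside Γ₁ or removes the
  -- ⊤-structure Γ₂ next to an added unit ⊤*; in the latter case the result
  -- is still an essence of Γ₁.
  drop-essence : ∀ {Γ₁ Δ Δ'} → Essence Γ₁ Δ → Drop⊤ Δ Δ' →
                 (Σ Str λ Γ₁' → Drop⊤ Γ₁ Γ₁' × Essence Γ₁' Δ') ⊎ Essence Γ₁ Δ'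
  drop-essence e-self r = inj₁ (_ , r , e-self)
  drop-essence (e-≈ e x) r with proj₂ (transport x) r
  ... | _ , r₁ , q with drop-essence e r₁
  ... | inj₁ (g , rg , e') = inj₁ (g , rg , e-≈ e' (≈-sym q))
  ... | inj₂ e' = inj₂ (e-≈ e' (≈-sym q))
  drop-essence (e-ii C Γ' Γ₂ e) r with split C r
  ... | in-ctx rc with drop-essence e (drop-ctx Γ' rc)
  ... | inj₁ (g , rg , e') = inj₁ (g , rg , e-ii _ Γ' Γ₂ e')
  ... | inj₂ e' = inj₂ (e-ii _ Γ' Γ₂ e')
  drop-essence (e-ii C Γ' Γ₂ e) r | in-hole (，₁ d) with drop-essence e (drop-hole C d)
  ... | inj₁ (g , rg , e') = inj₁ (g , rg , e-ii C _ Γ₂ e')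
  ... | inj₂ e' = inj₂ (e-ii C _ Γ₂ e')
  drop-essence (e-ii C Γ' (just G) e) r | in-hole (，₂ (drop₁ p)) = inj₂ (e-ii C Γ' nothing e)
  drop-essence (e-ii C Γ' (just G) e) r | in-hole (，₂ (；₁ d)) = inj₂ (e-ii C Γ' (just _) e)

  drop-head : ∀ {m P X} → P ≢ ⊤ᶠ → Drop⊤ (m ；? ⌊ P ⌋) X → Σ (Maybe Str) λ m' → X ≡ (m' ；? ⌊ P ⌋)
  drop-head {just _} P≢⊤ (drop₁ p) = nothing , refl
  drop-head {just _} P≢⊤ (drop₂ refl) = ⊥-elim (P≢⊤ refl)
  drop-head {just _} P≢⊤ (；₁ d) = just _ , refl

  essence-step : ∀ {m P E E'} → P ≢ ⊤ᶠ → Ess (m ；? ⌊ P ⌋) E → Drop⊤ E E' →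
                 Σ (Maybe Str) λ m' → Ess (m' ；? ⌊ P ⌋) E'
  essence-step {m} P≢⊤ e r with drop-essence (toEssence e) r
  ... | inj₂ e' = m , fromEssence e'
  ... | inj₁ (_ , rg , e') with drop-head P≢⊤ rg
  ... | m' , refl = m' , fromEssence e'

  -- How a candidate component may change under a deletion: it loses a ⊤,
  -- or (when the weakening that produced it is the deleted ⊤) a ⊤ leaf of
  -- it is traded for the structure the ⊤ was weakened with.
  data ⊤-Change (A B : Str) : Set where
    drop  : Drop⊤ A B → ⊤-Change A B
    trade : ∀ {W} → Replace ⊤ᶠ W A B → ⊤-Change A B

  drop-⪯ : ∀ {X S S'} → X ⪯ S → Drop⊤ S S' → (X ⪯ S') ⊎ (Σ Str λ X' → ⊤-Change X X' × X' ⪯ S')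
  drop-⪯ (⪯-≈ x) r with proj₂ (transport x) r
  ... | _ , r₁ , q = inj₂ (_ , drop r₁ , ⪯-≈ (≈-sym q))
  drop-⪯ (⪯-trans p q) r with drop-⪯ q r
  ... | inj₁ q' = inj₁ (⪯-trans p q')
  ... | inj₂ (_ , drop rm , q') with drop-⪯ p rm
  ... | inj₁ p' = inj₁ (⪯-trans p' q')
  ... | inj₂ (X' , rx , p') = inj₂ (X' , rx , ⪯-trans p' q')
  drop-⪯ (⪯-trans p q) r | inj₂ (_ , trade rm , q') with ReplaceProperties.replace-⪯ p rm
  ... | inj₁ p' = inj₁ (⪯-trans p' q')
  ... | inj₂ (X' , rx , p') = inj₂ (X' , trade rx , ⪯-trans p' q')
  drop-⪯ (⪯-weak C G G') r with split C r
  ... | in-ctx rc = inj₂ (_ , drop (drop-ctx G rc) , ⪯-weak _ G G')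
  ... | in-hole (drop₁ refl) = inj₂ (_ , trade (ReplaceProperties.replace-hole C (here refl)) , ⪯-≈ ≈-refl)
  ... | in-hole (drop₂ p) = inj₁ (⪯-≈ ≈-refl)
  ... | in-hole (；₁ d) = inj₂ (_ , drop (drop-hole C d) , ⪯-weak C _ G')
  ... | in-hole (；₂ d) = inj₁ (⪯-weak C G _)

  drop-candidate : ∀ {S S' R₁ R₂} → Candidate S R₁ R₂ → Drop⊤ S S' →
                   Σ Str λ R₁' → Σ Str λ R₂' →
                   Candidate S' R₁' R₂' × (⊤-Change ⁼) R₁ R₁' × (⊤-Change ⁼) R₂ R₂'
  drop-candidate (cand-unit p) r with drop-⪯ p r
  ... | inj₁ p' = _ , _ , cand-unit p' , inj₁ refl , inj₁ refl
  ... | inj₂ (_ , rx , p') = _ , _ , cand-unit p' , inj₂ rx , inj₁ refl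
  drop-candidate (cand-pair p) r with drop-⪯ p r
  ... | inj₁ p' = _ , _ , cand-pair p' , inj₁ refl , inj₁ refl
  ... | inj₂ (_ , drop (，₁ rx) , p') = _ , _ , cand-pair p' , inj₂ (drop rx) , inj₁ refl
  ... | inj₂ (_ , drop (，₂ rx) , p') = _ , _ , cand-pair p' , inj₁ refl , inj₂ (drop rx)
  ... | inj₂ (_ , trade (，₁ rx) , p') = _ , _ , cand-pair p' , inj₂ (trade rx) , inj₁ refl
  ... | inj₂ (_ , trade (，₂ rx) , p') = _ , _ , cand-pair p' , inj₁ refl , inj₂ (trade rx)

  drop-candidate± : ∀ {S S' R₁ R₂} → Candidate± S R₁ R₂ → Drop⊤ S S' →
                    Σ Str λ R₁' → Σ Str λ R₂' →
                    Candidate± S' R₁' R₂' × (⊤-Change ⁼) R₁ R₁' × (⊤-Change ⁼) R₂ R₂'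
  drop-candidate± (inj₁ c) r =
    let (R₁' , R₂' , c' , r₁ , r₂) = drop-candidate c r in R₁' , R₂' , inj₁ c' , r₁ , r₂
  drop-candidate± (inj₂ c) r =
    let (R₂' , R₁' , c' , r₂ , r₁) = drop-candidate c r in R₁' , R₂' , inj₂ c' , r₁ , r₂

  change-residue : ∀ C {A B} G W → (⊤-Change ⁼) A B →
                   (⊤-Change ⁼) (C [ (A ， ⌊ G ⌋) ； W ]) (C [ (B ， ⌊ G ⌋) ； W ])
  change-residue C G W = ⁼-map ⊤-Change (λ A → C [ (A ， ⌊ G ⌋) ； W ]) under
    where
    under : ∀ {A B} → ⊤-Change A B → ⊤-Change (C [ (A ， ⌊ G ⌋) ； W ]) (C [ (B ， ⌊ G ⌋) ； W ])
    under (drop x) = drop (drop-hole C (；₁ (，₁ x)))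
    under (trade x) = trade (ReplaceProperties.replace-hole C (；₁ (，₁ x)))

-- Depth-preserving admissibility of deleting a ⊤ argument of ";", by
-- induction on the depth bound; in the candidate pairs of ✶R and -✶L the
-- deletion may become a trade of ⊤ for a structure, handled by Replacement.
module DropUnit where
  open Drop⊤Properties

  drop-⊤ : ∀ n → Admissible n Drop⊤
  change⁼ : ∀ n → Admissible n (⊤-Change ⁼)
  drop-✶R : ∀ n {Γ Γ₀ F₁ F₂ R₁ R₂} → Candidate± Γ R₁ R₂ → Drop⊤ Γ Γ₀ →
            DerivableIn n R₁ F₁ → DerivableIn n R₂ F₂ → DerivableIn (suc n) Γ₀ (F₁ ✶ F₂)
  drop--✶L : ∀ n {Γ Γ₀ H} C Γ' m F G E {Rᵢ Rⱼ} → Candidate± Γ' Rᵢ Rⱼ →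
             Ess (m ；? ⌊ F -✶ G ⌋) E → Γ ≈ C [ Γ' ， E ] → Drop⊤ Γ Γ₀ →
             DerivableIn n Rᵢ F → DerivableIn n (C [ (Rⱼ ， ⌊ G ⌋) ； (Γ' ， E) ]) H →
             DerivableIn (suc n) Γ₀ H

  change⁼ n = admissible-⁼ change
    where
    change : Admissible n ⊤-Change
    change (drop r) = drop-⊤ n r
    change (trade r) = Replacement.replace ⊤-any n r

  drop-✶R n c r d₁ d₂ =
    let (R₁' , R₂' , c' , r₁ , r₂) = drop-candidate± c r in
    ✶R±≤ c' (change⁼ n r₁ d₁) (change⁼ n r₂ d₂)

  drop--✶L n C Γ' m F G E c e eq r d₁ d₂ with locate eq r
  ... | in-ctx rc q = -✶L±≤ _ Γ' m F G E c e q d₁ (drop-⊤ n (drop-ctx _ rc) d₂)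
  ... | in-hole (，₂ re) q =
    let (m' , e') = essence-step (λ ()) e re in
    -✶L±≤ C Γ' m' F G _ c e' q d₁ (drop-⊤ n (drop-hole C (；₂ (，₂ re))) d₂)
  ... | in-hole (，₁ rg) q =
    let (Rᵢ' , Rⱼ' , c' , rᵢ , rⱼ) = drop-candidate± c rg in
    -✶L±≤ C _ m F G E c' e q (change⁼ n rᵢ d₁)
      (change⁼ n (change-residue C G _ rⱼ) (drop-⊤ n (drop-hole C (；₂ (，₁ rg))) d₂))

  drop-⊤ n r (id m p e , le) = let (m' , e') = essence-step (λ ()) e r in id m' p e' , le
  drop-⊤ n r (⊥L C eq , le) with locate eq r
  ... | in-ctx _ q = ⊥L _ q , le
  drop-⊤ n r (⊤R , le) = ⊤R , le
  drop-⊤ n r (⊤*R m e , le) = let (m' , e') = essence-step (λ ()) e r in ⊤*R m' e' , le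
  drop-⊤ (suc n) r (∧L C F G eq d , s≤s le) with locate eq r
  ... | in-ctx rc q = ∧L≤ _ F G q (drop-⊤ n (drop-ctx _ rc) (d , le))
  drop-⊤ (suc n) r (∧R d₁ d₂ , s≤s le) =
    ∧R≤ (drop-⊤ n r (premise₁ d₁ le)) (drop-⊤ n r (premise₂ d₂ le))
  drop-⊤ (suc n) r (∨L C F G eq d₁ d₂ , s≤s le) with locate eq r
  ... | in-ctx rc q =
    ∨L≤ _ F G q (drop-⊤ n (drop-ctx _ rc) (premise₁ d₁ le)) (drop-⊤ n (drop-ctx _ rc) (premise₂ d₂ le))
  drop-⊤ (suc n) r (∨R₁ d , s≤s le) = ∨R₁≤ (drop-⊤ n r (d , le))
  drop-⊤ (suc n) r (∨R₂ d , s≤s le) = ∨R₂≤ (drop-⊤ n r (d , le))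
  drop-⊤ (suc n) r (⊃L C m F G E e eq d₁ d₂ , s≤s le) with locate eq r
  ... | in-ctx rc q = ⊃L≤ _ m F G E e q (premise₁ d₁ le) (drop-⊤ n (drop-ctx _ rc) (premise₂ d₂ le))
  ... | in-hole re q =
    let (m' , e') = essence-step (λ ()) e re in
    ⊃L≤ C m' F G _ e' q (drop-⊤ n re (premise₁ d₁ le)) (drop-⊤ n (drop-hole C (；₂ re)) (premise₂ d₂ le))
  ... | is-unit refl with essence-leaf-head e
  ... | ()
  drop-⊤ (suc n) r (⊃R d , s≤s le) = ⊃R≤ (drop-⊤ n (；₁ r) (d , le))
  drop-⊤ (suc n) r (✶L C F G eq d , s≤s le) with locate eq r
  ... | in-ctx rc q = ✶L≤ _ F G q (drop-⊤ n (drop-ctx _ rc) (d , le))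
  drop-⊤ (suc n) r (✶R₁₂ R₁ R₂ c d₁ d₂ , s≤s le) = drop-✶R n (inj₁ c) r (premise₁ d₁ le) (premise₂ d₂ le)
  drop-⊤ (suc n) r (✶R₂₁ R₁ R₂ c d₁ d₂ , s≤s le) = drop-✶R n (inj₂ c) r (premise₁ d₁ le) (premise₂ d₂ le)
  drop-⊤ (suc n) r (-✶L₁₂ C Γ' m F G E R₁ R₂ c e eq d₁ d₂ , s≤s le) =
    drop--✶L n C Γ' m F G E (inj₁ c) e eq r (premise₁ d₁ le) (premise₂ d₂ le)
  drop-⊤ (suc n) r (-✶L₂₁ C Γ' m F G E R₁ R₂ c e eq d₁ d₂ , s≤s le) =
    drop--✶L n C Γ' m F G E (inj₂ c) e eq r (premise₁ d₁ le) (premise₂ d₂ le)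
  drop-⊤ (suc n) r (-✶L₀ C m F G E e eq d₁ d₂ , s≤s le) with locate eq r
  ... | in-ctx rc q = -✶L₀≤ _ m F G E e q (premise₁ d₁ le) (drop-⊤ n (drop-ctx _ rc) (premise₂ d₂ le))
  ... | in-hole re q =
    let (m' , e') = essence-step (λ ()) e re in
    -✶L₀≤ C m' F G _ e' q (premise₁ d₁ le) (drop-⊤ n (drop-hole C (；₂ re)) (premise₂ d₂ le))
  ... | is-unit refl with essence-leaf-head e
  ... | ()
  drop-⊤ (suc n) r (-✶R d , s≤s le) = -✶R≤ (drop-⊤ n (，₁ r) (d , le))

data Drop⊤* : Str → Str → Set where
  drop₁ : ∀ {U A} → U ≡ ⌊ ⊤* ⌋ → Drop⊤* (U ， A) A
  drop₂ : ∀ {A U} → U ≡ ⌊ ⊤* ⌋ → Drop⊤* (A ， U) A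
  ；₁   : ∀ {A A' B} → Drop⊤* A A' → Drop⊤* (A ； B) (A' ； B)
  ；₂   : ∀ {A B B'} → Drop⊤* B B' → Drop⊤* (A ； B) (A ； B')
  ，₁   : ∀ {A A' B} → Drop⊤* A A' → Drop⊤* (A ， B) (A' ， B)
  ，₂   : ∀ {A B B'} → Drop⊤* B B' → Drop⊤* (A ， B) (A ， B')

data Drop⊤*Ctx : Ctx → Ctx → Set where
  drop-sibling₁ : ∀ {U C} → U ≡ ⌊ ⊤* ⌋ → Drop⊤*Ctx (U ，ʳ C) C
  drop-sibling₂ : ∀ {U C} → U ≡ ⌊ ⊤* ⌋ → Drop⊤*Ctx (C ，ˡ U) C
  ；ˡ-ctx : ∀ {C C' B} → Drop⊤*Ctx C C' → Drop⊤*Ctx (C ；ˡ B) (C' ；ˡ B)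
  ；ˡ-str : ∀ {C B B'} → Drop⊤* B B' → Drop⊤*Ctx (C ；ˡ B) (C ；ˡ B')
  ；ʳ-ctx : ∀ {C C' B} → Drop⊤*Ctx C C' → Drop⊤*Ctx (B ；ʳ C) (B ；ʳ C')
  ；ʳ-str : ∀ {C B B'} → Drop⊤* B B' → Drop⊤*Ctx (B ；ʳ C) (B' ；ʳ C)
  ，ˡ-ctx : ∀ {C C' B} → Drop⊤*Ctx C C' → Drop⊤*Ctx (C ，ˡ B) (C' ，ˡ B)
  ，ˡ-str : ∀ {C B B'} → Drop⊤* B B' → Drop⊤*Ctx (C ，ˡ B) (C ，ˡ B')
  ，ʳ-ctx : ∀ {C C' B} → Drop⊤*Ctx C C' → Drop⊤*Ctx (B ，ʳ C) (B ，ʳ C')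
  ，ʳ-str : ∀ {C B B'} → Drop⊤* B B' → Drop⊤*Ctx (B ，ʳ C) (B' ，ʳ C)

-- The same development as for Drop⊤, with the roles of ";" and "," swapped.
module Drop⊤*Properties where

  drop-ctx : ∀ {C C'} X → Drop⊤*Ctx C C' → Drop⊤* (C [ X ]) (C' [ X ])
  drop-ctx X (drop-sibling₁ p) = drop₁ p
  drop-ctx X (drop-sibling₂ p) = drop₂ p
  drop-ctx X (；ˡ-ctx r) = ；₁ (drop-ctx X r)
  drop-ctx X (；ˡ-str r) = ；₂ r
  drop-ctx X (；ʳ-ctx r) = ；₂ (drop-ctx X r)
  drop-ctx X (；ʳ-str r) = ；₁ r
  drop-ctx X (，ˡ-ctx r) = ，₁ (drop-ctx X r)
  drop-ctx X (，ˡ-str r) = ，₂ r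
  drop-ctx X (，ʳ-ctx r) = ，₂ (drop-ctx X r)
  drop-ctx X (，ʳ-str r) = ，₁ r

  drop-hole : ∀ C {X X'} → Drop⊤* X X' → Drop⊤* (C [ X ]) (C [ X' ])
  drop-hole ─ r = r
  drop-hole (C ；ˡ _) r = ；₁ (drop-hole C r)
  drop-hole (_ ；ʳ C) r = ；₂ (drop-hole C r)
  drop-hole (C ，ˡ _) r = ，₁ (drop-hole C r)
  drop-hole (_ ，ʳ C) r = ，₂ (drop-hole C r)

  data Split (C : Ctx) (X : Str) : Str → Set where
    in-ctx  : ∀ {C'} → Drop⊤*Ctx C C' → Split C X (C' [ X ])
    in-hole : ∀ {X'} → Drop⊤* X X' → Split C X (C [ X' ])
    is-unit : ∀ {T} → X ≡ ⌊ ⊤* ⌋ → Split C X T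

  split : ∀ C {X T} → Drop⊤* (C [ X ]) T → Split C X T
  split ─ r = in-hole r
  split (C ，ˡ B) (drop₂ p) = in-ctx (drop-sibling₂ p)
  split (C ，ˡ B) (drop₁ p) = is-unit (proj₂ (plug-leaf C p))
  split (C ，ˡ B) (，₁ r) with split C r
  ... | in-ctx rc = in-ctx (，ˡ-ctx rc)
  ... | in-hole r' = in-hole r'
  ... | is-unit p = is-unit p
  split (C ，ˡ B) (，₂ r) = in-ctx (，ˡ-str r)
  split (B ，ʳ C) (drop₁ p) = in-ctx (drop-sibling₁ p)
  split (B ，ʳ C) (drop₂ p) = is-unit (proj₂ (plug-leaf C p))
  split (B ，ʳ C) (，₂ r) with split C r
  ... | in-ctx rc = in-ctx (，ʳ-ctx rc)
  ... | in-hole r' = in-hole r'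
  ... | is-unit p = is-unit p
  split (B ，ʳ C) (，₁ r) = in-ctx (，ʳ-str r)
  split (C ；ˡ B) (；₁ r) with split C r
  ... | in-ctx rc = in-ctx (；ˡ-ctx rc)
  ... | in-hole r' = in-hole r'
  ... | is-unit p = is-unit p
  split (C ；ˡ B) (；₂ r) = in-ctx (；ˡ-str r)
  split (B ；ʳ C) (；₂ r) with split C r
  ... | in-ctx rc = in-ctx (；ʳ-ctx rc)
  ... | in-hole r' = in-hole r'
  ... | is-unit p = is-unit p
  split (B ；ʳ C) (；₁ r) = in-ctx (；ʳ-str r)

  Transports : Str → Str → Set
  Transports A B = ∀ {A'} → Drop⊤* A A' → Σ Str λ B' → Drop⊤* B B' × A' ≈ B'

  transport-；-cong : ∀ {A A' B B'} → A ≈ A' → B ≈ B' → Transports A A' → Transports B B' →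
                      Transports (A ； B) (A' ； B')
  transport-；-cong e f tA tB (；₁ r) = let (_ , r' , q) = tA r in _ , ；₁ r' , ；-cong q f
  transport-；-cong e f tA tB (；₂ r) = let (_ , r' , q) = tB r in _ , ；₂ r' , ；-cong e q

  transport-，-cong : ∀ {A A' B B'} → A ≈ A' → B ≈ B' → Transports A A' → Transports B B' →
                      Transports (A ， B) (A' ， B')
  transport-，-cong e f tA tB (drop₁ refl) = _ , drop₁ (leaf-rigidʳ e) , f
  transport-，-cong e f tA tB (drop₂ refl) = _ , drop₂ (leaf-rigidʳ f) , e
  transport-，-cong e f tA tB (，₁ r) = let (_ , r' , q) = tA r in _ , ，₁ r' , ，-cong q f
  transport-，-cong e f tA tB (，₂ r) = let (_ , r' , q) = tB r in _ , ，₂ r' , ，-cong e q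

  transport : ∀ {A B} → A ≈ B → Transports A B × Transports B A
  transport ≈-refl = (λ r → _ , r , ≈-refl) , (λ r → _ , r , ≈-refl)
  transport (≈-sym e) = proj₂ (transport e) , proj₁ (transport e)
  transport (≈-trans e f) = compose (proj₁ (transport e)) (proj₁ (transport f)) ,
                            compose (proj₂ (transport f)) (proj₂ (transport e))
    where
    compose : ∀ {A B C} → Transports A B → Transports B C → Transports A C
    compose t u r = let (_ , r₁ , q₁) = t r ; (_ , r₂ , q₂) = u r₁ in _ , r₂ , ≈-trans q₁ q₂
  transport (；-cong e f) =
    transport-；-cong e f (proj₁ (transport e)) (proj₁ (transport f)) ,
    transport-；-cong (≈-sym e) (≈-sym f) (proj₂ (transport e)) (proj₂ (transport f))
  transport (，-cong e f) =
    transport-，-cong e f (proj₁ (transport e)) (proj₁ (transport f)) ,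
    transport-，-cong (≈-sym e) (≈-sym f) (proj₂ (transport e)) (proj₂ (transport f))
  transport ，-assoc = fw , bw
    where
    fw : Transports _ _
    fw (drop₂ p) = _ , ，₂ (drop₂ p) , ≈-refl
    fw (，₁ (drop₁ p)) = _ , drop₁ p , ≈-refl
    fw (，₁ (drop₂ p)) = _ , ，₂ (drop₁ p) , ≈-refl
    fw (，₁ (，₁ r)) = _ , ，₁ r , ，-assoc
    fw (，₁ (，₂ r)) = _ , ，₂ (，₁ r) , ，-assoc
    fw (，₂ r) = _ , ，₂ (，₂ r) , ，-assoc
    bw : Transports _ _
    bw (drop₁ p) = _ , ，₁ (drop₁ p) , ≈-refl
    bw (，₂ (drop₁ p)) = _ , ，₁ (drop₂ p) , ≈-refl
    bw (，₂ (drop₂ p)) = _ , drop₂ p , ≈-refl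
    bw (，₁ r) = _ , ，₁ (，₁ r) , ≈-sym ，-assoc
    bw (，₂ (，₁ r)) = _ , ，₁ (，₂ r) , ≈-sym ，-assoc
    bw (，₂ (，₂ r)) = _ , ，₂ r , ≈-sym ，-assoc
  transport ，-comm = commute , commute
    where
    commute : ∀ {A B} → Transports (A ， B) (B ， A)
    commute (drop₁ p) = _ , drop₂ p , ≈-refl
    commute (drop₂ p) = _ , drop₁ p , ≈-refl
    commute (，₁ r) = _ , ，₂ r , ，-comm
    commute (，₂ r) = _ , ，₁ r , ，-comm
  transport ；-assoc = fw , bw
    where
    fw : Transports _ _
    fw (；₁ (；₁ r)) = _ , ；₁ r , ；-assoc
    fw (；₁ (；₂ r)) = _ , ；₂ (；₁ r) , ；-assoc
    fw (；₂ r) = _ , ；₂ (；₂ r) , ；-assoc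
    bw : Transports _ _
    bw (；₁ r) = _ , ；₁ (；₁ r) , ≈-sym ；-assoc
    bw (；₂ (；₁ r)) = _ , ；₁ (；₂ r) , ≈-sym ；-assoc
    bw (；₂ (；₂ r)) = _ , ；₂ r , ≈-sym ；-assoc
  transport ；-comm = commute , commute
    where
    commute : ∀ {A B} → Transports (A ； B) (B ； A)
    commute (；₁ r) = _ , ；₂ r , ；-comm
    commute (；₂ r) = _ , ；₁ r , ；-comm

  data Located (C : Ctx) (X : Str) (Γ' : Str) : Set where
    in-ctx  : ∀ {C'} → Drop⊤*Ctx C C' → Γ' ≈ C' [ X ] → Located C X Γ'
    in-hole : ∀ {X'} → Drop⊤* X X' → Γ' ≈ C [ X' ] → Located C X Γ'
    is-unit : X ≡ ⌊ ⊤* ⌋ → Located C X Γ'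

  locate : ∀ {Γ Γ' C X} → Γ ≈ C [ X ] → Drop⊤* Γ Γ' → Located C X Γ'
  locate {C = C} eq r with proj₁ (transport eq) r
  ... | _ , r₁ , q with split C r₁
  ... | in-ctx rc = in-ctx rc q
  ... | in-hole r' = in-hole r' q
  ... | is-unit p = is-unit p

  -- How the base Γ₁ of an essence changes when a ⊤* is deleted from the
  -- essence: it loses a ⊤*, or (when a ⊤* of Γ₁ absorbed the ⊤* added next
  -- to it together with an additive part Z) that ⊤* becomes Z ; ⊤*.
  data BaseChange (A B : Str) : Set where
    drop   : Drop⊤* A B → BaseChange A B
    absorb : ∀ {Z} → Replace ⊤* (Z ； ⌊ ⊤* ⌋) A B → BaseChange A B

  drop-essence : ∀ {Γ₁ Δ Δ'} → Essence Γ₁ Δ → Drop⊤* Δ Δ' →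
                 Σ Str λ Γ₁' → (BaseChange ⁼) Γ₁ Γ₁' × Essence Γ₁' Δ'
  drop-essence e-self r = _ , inj₂ (drop r) , e-self
  drop-essence (e-≈ e x) r with proj₂ (transport x) r
  ... | _ , r₁ , q = let (g , rg , e') = drop-essence e r₁ in g , rg , e-≈ e' (≈-sym q)
  drop-essence (e-ii C Γ' Γ₂ e) r with split C r
  ... | in-ctx rc = let (g , rg , e') = drop-essence e (drop-ctx Γ' rc) in g , rg , e-ii _ Γ' Γ₂ e'
  ... | in-hole (，₁ d) = let (g , rg , e') = drop-essence e (drop-hole C d) in g , rg , e-ii C _ Γ₂ e'
  drop-essence (e-ii C Γ' nothing e) r | in-hole (drop₂ p) = _ , inj₁ refl , e
  drop-essence (e-ii C Γ' nothing e) r | in-hole (drop₁ refl) = _ , inj₁ refl , e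
  drop-essence (e-ii C Γ' (just G) e) r | in-hole (drop₁ refl)
    with ReplaceProperties.replace-essence (λ _ → G , refl) e (ReplaceProperties.replace-hole C (here refl))
  ... | inj₁ (g , rg , e') = g , inj₂ (absorb rg) , e'
  ... | inj₂ e' = _ , inj₁ refl , e'
  drop-essence (e-ii C Γ' (just G) e) r | in-hole (，₂ (；₁ d)) = _ , inj₁ refl , e-ii C Γ' (just _) e

  drop-head : ∀ {m P X} → (BaseChange ⁼) (m ；? ⌊ P ⌋) X → Σ (Maybe Str) λ m' → X ≈ (m' ；? ⌊ P ⌋)
  drop-head {m} (inj₁ refl) = m , ≈-refl
  drop-head {just _} (inj₂ (drop (；₁ d))) = just _ , ≈-refl
  drop-head {P = P} (inj₂ (absorb {Z} r)) = ReplaceProperties.replace-head absorbed r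
    where
    absorbed : ⊤* ≡ P → Σ Str λ Z' → Z ； ⌊ ⊤* ⌋ ≡ Z' ； ⌊ P ⌋
    absorbed refl = Z , refl

  essence-step : ∀ {m P E E'} → Ess (m ；? ⌊ P ⌋) E → Drop⊤* E E' →
                 Σ (Maybe Str) λ m' → Ess (m' ；? ⌊ P ⌋) E'
  essence-step e r with drop-essence (toEssence e) r
  ... | _ , rg , e' with drop-head rg
  ... | m' , q = m' , fromEssence (essence-base-≈ e' q)

  drop-⪯ : ∀ {X S S'} → X ⪯ S → Drop⊤* S S' → (X ⪯ S') ⊎ (Σ Str λ X' → Drop⊤* X X' × X' ⪯ S')
  drop-⪯ (⪯-≈ x) r with proj₂ (transport x) r
  ... | _ , r₁ , q = inj₂ (_ , r₁ , ⪯-≈ (≈-sym q))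
  drop-⪯ (⪯-trans p q) r with drop-⪯ q r
  ... | inj₁ q' = inj₁ (⪯-trans p q')
  ... | inj₂ (_ , rm , q') with drop-⪯ p rm
  ... | inj₁ p' = inj₁ (⪯-trans p' q')
  ... | inj₂ (X' , rx , p') = inj₂ (X' , rx , ⪯-trans p' q')
  drop-⪯ (⪯-weak C G G') r with split C r
  ... | in-ctx rc = inj₂ (_ , drop-ctx G rc , ⪯-weak _ G G')
  ... | in-hole (；₁ d) = inj₂ (_ , drop-hole C d , ⪯-weak C _ G')
  ... | in-hole (；₂ d) = inj₁ (⪯-weak C G _)

  -- Deleting the ⊤* component of a pair (R , ⊤*) turns it into the unit
  -- candidate (R , ⊤*), possibly in the other order.
  drop-candidate : ∀ {S S' R₁ R₂} → Candidate S R₁ R₂ → Drop⊤* S S' →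
                   Σ Str λ R₁' → Σ Str λ R₂' →
                   Candidate± S' R₁' R₂' × (Drop⊤* ⁼) R₁ R₁' × (Drop⊤* ⁼) R₂ R₂'
  drop-candidate (cand-unit p) r with drop-⪯ p r
  ... | inj₁ p' = _ , _ , inj₁ (cand-unit p') , inj₁ refl , inj₁ refl
  ... | inj₂ (_ , rx , p') = _ , _ , inj₁ (cand-unit p') , inj₂ rx , inj₁ refl
  drop-candidate (cand-pair p) r with drop-⪯ p r
  ... | inj₁ p' = _ , _ , inj₁ (cand-pair p') , inj₁ refl , inj₁ refl
  ... | inj₂ (_ , drop₂ refl , p') = _ , _ , inj₁ (cand-unit p') , inj₁ refl , inj₁ refl
  ... | inj₂ (_ , drop₁ refl , p') = _ , _ , inj₂ (cand-unit p') , inj₁ refl , inj₁ refl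
  ... | inj₂ (_ , ，₁ rx , p') = _ , _ , inj₁ (cand-pair p') , inj₂ rx , inj₁ refl
  ... | inj₂ (_ , ，₂ rx , p') = _ , _ , inj₁ (cand-pair p') , inj₁ refl , inj₂ rx

  drop-candidate± : ∀ {S S' R₁ R₂} → Candidate± S R₁ R₂ → Drop⊤* S S' →
                    Σ Str λ R₁' → Σ Str λ R₂' →
                    Candidate± S' R₁' R₂' × (Drop⊤* ⁼) R₁ R₁' × (Drop⊤* ⁼) R₂ R₂'
  drop-candidate± (inj₁ c) r = drop-candidate c r
  drop-candidate± (inj₂ c) r =
    let (R₂' , R₁' , c' , r₂ , r₁) = drop-candidate c r in R₁' , R₂' , swap c' , r₁ , r₂

  drop-residue : ∀ C {A B} G W → (Drop⊤* ⁼) A B →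
                 (Drop⊤* ⁼) (C [ (A ， ⌊ G ⌋) ； W ]) (C [ (B ， ⌊ G ⌋) ； W ])
  drop-residue C G W = ⁼-map Drop⊤* (λ A → C [ (A ， ⌊ G ⌋) ； W ]) (λ x → drop-hole C (；₁ (，₁ x)))

-- The new phenomenon is -✶L whose Γ' is the
-- deleted ⊤*: its candidate pair is (⊤*, ⊤*) and the instance becomes one
-- of -✶L with Γ' absent, after deleting two further copies of ⊤*.
module DropMultiplicativeUnit where
  open Drop⊤*Properties

  drop-⊤* : ∀ n → Admissible n Drop⊤*
  drop-⊤*⁼ : ∀ n → Admissible n (Drop⊤* ⁼)
  drop-✶R : ∀ n {Γ Γ₀ F₁ F₂ R₁ R₂} → Candidate± Γ R₁ R₂ → Drop⊤* Γ Γ₀ →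
            DerivableIn n R₁ F₁ → DerivableIn n R₂ F₂ → DerivableIn (suc n) Γ₀ (F₁ ✶ F₂)
  drop--✶L : ∀ n {Γ Γ₀ H} C Γ' m F G E {Rᵢ Rⱼ} → Candidate± Γ' Rᵢ Rⱼ →
             Ess (m ；? ⌊ F -✶ G ⌋) E → Γ ≈ C [ Γ' ， E ] → Drop⊤* Γ Γ₀ →
             DerivableIn n Rᵢ F → DerivableIn n (C [ (Rⱼ ， ⌊ G ⌋) ； (Γ' ， E) ]) H →
             DerivableIn (suc n) Γ₀ H

  drop-⊤*⁼ n = admissible-⁼ (drop-⊤* n)

  drop-✶R n c r d₁ d₂ =
    let (R₁' , R₂' , c' , r₁ , r₂) = drop-candidate± c r in
    ✶R±≤ c' (drop-⊤*⁼ n r₁ d₁) (drop-⊤*⁼ n r₂ d₂)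

  drop--✶L n C Γ' m F G E c e eq r d₁ d₂ with locate eq r
  ... | in-ctx rc q = -✶L±≤ _ Γ' m F G E c e q d₁ (drop-⊤* n (drop-ctx _ rc) d₂)
  ... | in-hole (，₂ re) q =
    let (m' , e') = essence-step e re in
    -✶L±≤ C Γ' m' F G _ c e' q d₁ (drop-⊤* n (drop-hole C (；₂ (，₂ re))) d₂)
  ... | in-hole (，₁ rg) q =
    let (Rᵢ' , Rⱼ' , c' , rᵢ , rⱼ) = drop-candidate± c rg in
    -✶L±≤ C _ m F G E c' e q (drop-⊤*⁼ n rᵢ d₁)
      (drop-⊤*⁼ n (drop-residue C G _ rⱼ) (drop-⊤* n (drop-hole C (；₂ (，₁ rg))) d₂))
  ... | in-hole (drop₂ refl) q with essence-leaf-head e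
  ... | ()
  drop--✶L n C Γ' m F G E c e eq r d₁ d₂ | in-hole (drop₁ refl) q with candidate±-⊤* c
  ... | refl , refl =
    -✶L₀≤ C m F G E e q d₁
      (drop-⊤* n (drop-hole C (；₂ (drop₁ refl))) (drop-⊤* n (drop-hole C (；₁ (drop₁ refl))) d₂))

  drop-⊤* n r (id m p e , le) = let (m' , e') = essence-step e r in id m' p e' , le
  drop-⊤* n r (⊥L C eq , le) with locate eq r
  ... | in-ctx _ q = ⊥L _ q , le
  drop-⊤* n r (⊤R , le) = ⊤R , le
  drop-⊤* n r (⊤*R m e , le) = let (m' , e') = essence-step e r in ⊤*R m' e' , le
  drop-⊤* (suc n) r (∧L C F G eq d , s≤s le) with locate eq r
  ... | in-ctx rc q = ∧L≤ _ F G q (drop-⊤* n (drop-ctx _ rc) (d , le))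
  drop-⊤* (suc n) r (∧R d₁ d₂ , s≤s le) =
    ∧R≤ (drop-⊤* n r (premise₁ d₁ le)) (drop-⊤* n r (premise₂ d₂ le))
  drop-⊤* (suc n) r (∨L C F G eq d₁ d₂ , s≤s le) with locate eq r
  ... | in-ctx rc q =
    ∨L≤ _ F G q (drop-⊤* n (drop-ctx _ rc) (premise₁ d₁ le)) (drop-⊤* n (drop-ctx _ rc) (premise₂ d₂ le))
  drop-⊤* (suc n) r (∨R₁ d , s≤s le) = ∨R₁≤ (drop-⊤* n r (d , le))
  drop-⊤* (suc n) r (∨R₂ d , s≤s le) = ∨R₂≤ (drop-⊤* n r (d , le))
  drop-⊤* (suc n) r (⊃L C m F G E e eq d₁ d₂ , s≤s le) with locate eq r
  ... | in-ctx rc q = ⊃L≤ _ m F G E e q (premise₁ d₁ le) (drop-⊤* n (drop-ctx _ rc) (premise₂ d₂ le))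
  ... | in-hole re q =
    let (m' , e') = essence-step e re in
    ⊃L≤ C m' F G _ e' q (drop-⊤* n re (premise₁ d₁ le)) (drop-⊤* n (drop-hole C (；₂ re)) (premise₂ d₂ le))
  ... | is-unit refl with essence-leaf-head e
  ... | ()
  drop-⊤* (suc n) r (⊃R d , s≤s le) = ⊃R≤ (drop-⊤* n (；₁ r) (d , le))
  drop-⊤* (suc n) r (✶L C F G eq d , s≤s le) with locate eq r
  ... | in-ctx rc q = ✶L≤ _ F G q (drop-⊤* n (drop-ctx _ rc) (d , le))
  drop-⊤* (suc n) r (✶R₁₂ R₁ R₂ c d₁ d₂ , s≤s le) = drop-✶R n (inj₁ c) r (premise₁ d₁ le) (premise₂ d₂ le)
  drop-⊤* (suc n) r (✶R₂₁ R₁ R₂ c d₁ d₂ , s≤s le) = drop-✶R n (inj₂ c) r (premise₁ d₁ le) (premise₂ d₂ le)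
  drop-⊤* (suc n) r (-✶L₁₂ C Γ' m F G E R₁ R₂ c e eq d₁ d₂ , s≤s le) =
    drop--✶L n C Γ' m F G E (inj₁ c) e eq r (premise₁ d₁ le) (premise₂ d₂ le)
  drop-⊤* (suc n) r (-✶L₂₁ C Γ' m F G E R₁ R₂ c e eq d₁ d₂ , s≤s le) =
    drop--✶L n C Γ' m F G E (inj₂ c) e eq r (premise₁ d₁ le) (premise₂ d₂ le)
  drop-⊤* (suc n) r (-✶L₀ C m F G E e eq d₁ d₂ , s≤s le) with locate eq r
  ... | in-ctx rc q = -✶L₀≤ _ m F G E e q (premise₁ d₁ le) (drop-⊤* n (drop-ctx _ rc) (premise₂ d₂ le))
  ... | in-hole re q =
    let (m' , e') = essence-step e re in
    -✶L₀≤ C m' F G _ e' q (premise₁ d₁ le) (drop-⊤* n (drop-hole C (；₂ re)) (premise₂ d₂ le))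
  ... | is-unit refl with essence-leaf-head e
  ... | ()
  drop-⊤* (suc n) r (-✶R d , s≤s le) = -✶R≤ (drop-⊤* n (，₁ r) (d , le))

-- Left rules do not inspect the goal and act anywhere in
-- the antecedent, so they can be re-applied inside an outer context O with
-- another goal.  Hence, to turn depth-≤n derivations of Γ ⊢ H into depth-≤n
-- derivations of O[Γ] ⊢ H', it suffices to treat those ending in a right
-- rule or in an axiom other than ⊥L.

data EndsRight : ∀ {Γ H} → Deriv Γ H → Set where
  by-id   : ∀ {Γ} m p (e : Ess (m ；? ⌊ var p ⌋) Γ) → EndsRight (id m p e)
  by-⊤R   : ∀ {Γ} → EndsRight (⊤R {Γ})
  by-⊤*R  : ∀ {Γ} m (e : Ess (m ；? ⌊ ⊤* ⌋) Γ) → EndsRight (⊤*R m e)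
  by-∧R   : ∀ {Γ F G} (d : Deriv Γ F) (e : Deriv Γ G) → EndsRight (∧R d e)
  by-∨R₁  : ∀ {Γ F G} (d : Deriv Γ F) → EndsRight (∨R₁ {G = G} d)
  by-∨R₂  : ∀ {Γ F G} (d : Deriv Γ G) → EndsRight (∨R₂ {F = F} d)
  by-⊃R   : ∀ {Γ F G} (d : Deriv (Γ ； ⌊ F ⌋) G) → EndsRight (⊃R d)
  by-✶R₁₂ : ∀ {Γ F₁ F₂} R₁ R₂ c (d : Deriv R₁ F₁) (e : Deriv R₂ F₂) →
            EndsRight (✶R₁₂ {Γ} R₁ R₂ c d e)
  by-✶R₂₁ : ∀ {Γ F₁ F₂} R₁ R₂ c (d : Deriv R₂ F₁) (e : Deriv R₁ F₂) →
            EndsRight (✶R₂₁ {Γ} R₁ R₂ c d e)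
  by--✶R  : ∀ {Γ F G} (d : Deriv (Γ ， ⌊ F ⌋) G) → EndsRight (-✶R d)

outer-≈ : ∀ O C {Γ X} → Γ ≈ C [ X ] → O [ Γ ] ≈ (O ∘ᶜ C) [ X ]
outer-≈ O C {X = X} eq = subst (_ ≈_) (sym (plug-∘ O C X)) (plug-cong O eq)

outer-derivable : ∀ O C {n X H} → DerivableIn n (O [ C [ X ] ]) H → DerivableIn n ((O ∘ᶜ C) [ X ]) H
outer-derivable O C {X = X} = subst (λ Δ → DerivableIn _ Δ _) (sym (plug-∘ O C X))

invert : ∀ (O : Ctx) {H H'} →
         (∀ {n Γ} {d : Deriv Γ H} → EndsRight d → depth d ≤ n → DerivableIn n (O [ Γ ]) H') →
         ∀ {n Γ} (d : Deriv Γ H) → depth d ≤ n → DerivableIn n (O [ Γ ]) H'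
invert O right (⊥L C eq) le = ⊥L (O ∘ᶜ C) (outer-≈ O C eq) , le
invert O right (∧L C F G eq d) (s≤s le) =
  ∧L≤ (O ∘ᶜ C) F G (outer-≈ O C eq) (outer-derivable O C (invert O right d le))
invert O right (∨L C F G eq d e) (s≤s le) =
  ∨L≤ (O ∘ᶜ C) F G (outer-≈ O C eq)
    (outer-derivable O C (invert O right d (⊔≤ˡ le))) (outer-derivable O C (invert O right e (⊔≤ʳ le)))
invert O right (⊃L C m F G E es eq d e) (s≤s le) =
  ⊃L≤ (O ∘ᶜ C) m F G E es (outer-≈ O C eq) (premise₁ d le) (outer-derivable O C (invert O right e (⊔≤ʳ le)))
invert O right (✶L C F G eq d) (s≤s le) =
  ✶L≤ (O ∘ᶜ C) F G (outer-≈ O C eq) (outer-derivable O C (invert O right d le))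
invert O right (-✶L₁₂ C Γ' m F G E R₁ R₂ c es eq d e) (s≤s le) =
  -✶L₁₂≤ (O ∘ᶜ C) Γ' m F G E R₁ R₂ c es (outer-≈ O C eq) (premise₁ d le)
    (outer-derivable O C (invert O right e (⊔≤ʳ le)))
invert O right (-✶L₂₁ C Γ' m F G E R₁ R₂ c es eq d e) (s≤s le) =
  -✶L₂₁≤ (O ∘ᶜ C) Γ' m F G E R₁ R₂ c es (outer-≈ O C eq) (premise₁ d le)
    (outer-derivable O C (invert O right e (⊔≤ʳ le)))
invert O right (-✶L₀ C m F G E es eq d e) (s≤s le) =
  -✶L₀≤ (O ∘ᶜ C) m F G E es (outer-≈ O C eq) (premise₁ d le)
    (outer-derivable O C (invert O right e (⊔≤ʳ le)))
invert O right (id m p e) le = right (by-id m p e) le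
invert O right ⊤R le = right by-⊤R le
invert O right (⊤*R m e) le = right (by-⊤*R m e) le
invert O right (∧R d e) le = right (by-∧R d e) le
invert O right (∨R₁ d) le = right (by-∨R₁ d) le
invert O right (∨R₂ d) le = right (by-∨R₂ d) le
invert O right (⊃R d) le = right (by-⊃R d) le
invert O right (✶R₁₂ R₁ R₂ c d e) le = right (by-✶R₁₂ R₁ R₂ c d e) le
invert O right (✶R₂₁ R₁ R₂ c d e) le = right (by-✶R₂₁ R₁ R₂ c d e) le
invert O right (-✶R d) le = right (by--✶R d) le

unary-premise : ∀ {n A F} (d : Deriv A F) → suc (depth d) ≤ n → DerivableIn n A F
unary-premise d le = d , <⇒≤ le

invert-∧ : ∀ {n Γ F G} → DerivableIn n Γ (F ∧ᶠ G) → DerivableIn n Γ F × DerivableIn n Γ G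
invert-∧ (d , le) = invert ─ first d le , invert ─ second d le
  where
  first : ∀ {n Γ F G} {d : Deriv Γ (F ∧ᶠ G)} → EndsRight d → depth d ≤ n → DerivableIn n Γ F
  first (by-∧R d e) le = premise₁ d (<⇒≤ le)
  second : ∀ {n Γ F G} {d : Deriv Γ (F ∧ᶠ G)} → EndsRight d → depth d ≤ n → DerivableIn n Γ G
  second (by-∧R d e) le = premise₂ e (<⇒≤ le)

invert-⊃ : ∀ {n Γ F G} → DerivableIn n Γ (F ⊃ G) → DerivableIn n (Γ ； ⌊ F ⌋) G
invert-⊃ {F = F} (d , le) = invert (─ ；ˡ ⌊ F ⌋) premise d le
  where
  premise : ∀ {n Γ G} {d : Deriv Γ (F ⊃ G)} → EndsRight d → depth d ≤ n → DerivableIn n (Γ ； ⌊ F ⌋) G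
  premise (by-⊃R d) le = unary-premise d le

invert--✶ : ∀ {n Γ F G} → DerivableIn n Γ (F -✶ G) → DerivableIn n (Γ ， ⌊ F ⌋) G
invert--✶ {F = F} (d , le) = invert (─ ，ˡ ⌊ F ⌋) premise d le
  where
  premise : ∀ {n Γ G} {d : Deriv Γ (F -✶ G)} → EndsRight d → depth d ≤ n → DerivableIn n (Γ ， ⌊ F ⌋) G
  premise (by--✶R d) le = unary-premise d le

lemma2 : (k : ℕ) → 1 ≤ k →
    -- (1)
    (∀ (C : Ctx) (F G H : Formula) →
      DerivableIn k (C [ ⌊ F ∧ᶠ G ⌋ ]) H → DerivableIn k (C [ ⌊ F ⌋ ； ⌊ G ⌋ ]) H)
  × -- (2)
    (∀ (C : Ctx) (F₁ F₂ H : Formula) →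
      DerivableIn k (C [ ⌊ F₁ ∨ᶠ F₂ ⌋ ]) H →
      DerivableIn k (C [ ⌊ F₁ ⌋ ]) H × DerivableIn k (C [ ⌊ F₂ ⌋ ]) H)
  × -- (3)
    (∀ (C : Ctx) (F G H : Formula) →
      DerivableIn k (C [ ⌊ F ✶ G ⌋ ]) H → DerivableIn k (C [ ⌊ F ⌋ ， ⌊ G ⌋ ]) H)
  × -- (4)
    (∀ (C : Ctx) (Γ₁ : Str) (H : Formula) →
      DerivableIn k (C [ Γ₁ ； ⌊ ⊤ᶠ ⌋ ]) H → DerivableIn k (C [ Γ₁ ]) H)
  × -- (5)
    (∀ (C : Ctx) (Γ₁ : Str) (H : Formula) →
      DerivableIn k (C [ Γ₁ ， ⌊ ⊤* ⌋ ]) H → DerivableIn k (C [ Γ₁ ]) H)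
  × -- (6)
    (∀ (Γ : Str) (F G : Formula) →
      DerivableIn k Γ (F ∧ᶠ G) → DerivableIn k Γ F × DerivableIn k Γ G)
  × -- (7)
    (∀ (Γ : Str) (F G : Formula) →
      DerivableIn k Γ (F ⊃ G) → DerivableIn k (Γ ； ⌊ F ⌋) G)
  × -- (8)
    (∀ (Γ : Str) (F G : Formula) →
      DerivableIn k Γ (F -✶ G) → DerivableIn k (Γ ， ⌊ F ⌋) G)
lemma2 k _ =
    (λ C F G H → replace ∧-parts k (principal C))
  , (λ C F₁ F₂ H d → replace ∨-part₁ k (principal C) d , replace ∨-part₂ k (principal C) d)
  , (λ C F G H → replace ✶-parts k (principal C))
  , (λ C Γ₁ H → DropUnit.drop-⊤ k (Drop⊤Properties.drop-hole C (drop₂ refl)))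
  , (λ C Γ₁ H → DropMultiplicativeUnit.drop-⊤* k (Drop⊤*Properties.drop-hole C (drop₂ refl)))
  , (λ Γ F G → invert-∧)
  , (λ Γ F G → invert-⊃)
  , (λ Γ F G → invert--✶)
  where
  open Replacement using (replace)
  principal : ∀ C {L Y} → Replace L Y (C [ ⌊ L ⌋ ]) (C [ Y ])
  principal C = ReplaceProperties.replace-hole C (here refl)
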